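{- There exist absolute constants $c_1,c_2>0$ such that for all sufficiently large $n$ there is a graph on $n$ vertices with edge density at least $c_1/\log n$ which is the union of at most $n^{1+c_2/\log\log n}$ induced matchings.
   Context: A matching $M$ in a graph $G$ is induced if the subgraph of $G$ induced on the vertices covered by $M$ has exactly the edges of $M$. -}

module Defs where

open import Data.Nat using (ℕ; zero; suc; _+_; _*_; _∸_; _^_; _≤_; _<_)
open import Data.Nat.Logarithm using (⌊log₂_⌋)
open import Data.Bool using (Bool; true; false; if_then_else_)
open import Data.Fin using (Fin)
open import Data.List using (List; map; allFin)
open import Data.Nat.ListAction using (sum)
open import Data.Product using (Σ; ∃; ∃-syntax; _×_)
open import Relation.Binary.PropositionalEquality using (_≡_)
open import Relation.Nullary using (¬_)

record SimpleGraph (n : ℕ) : Set where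
  field
    Adj   : Fin n → Fin n → Bool
    sym   : ∀ u v → Adj u v ≡ Adj v u
    loopless : ∀ v → Adj v v ≡ false
open SimpleGraph public

-- number of ordered pairs (u , v) with u ~ v, i.e. twice the number of edges
ordAdjCount : ∀ {n} → SimpleGraph n → ℕ
ordAdjCount {n} G =
  sum (map (λ u → sum (map (λ v → if Adj G u v then 1 else 0) (allFin n))) (allFin n))

-- A set of edges (spanning subgraph) given by a symmetric Bool-valued relation.
EdgeSet : ℕ → Set
EdgeSet n = Fin n → Fin n → Bool

Covered : ∀ {n} → EdgeSet n → Fin n → Set
Covered M v = ∃[ w ] M v w ≡ true

record IsInducedMatching {n : ℕ} (G : SimpleGraph n) (M : EdgeSet n) : Set where
  field
    symM     : ∀ u v → M u v ≡ M v u
    subset   : ∀ u v → M u v ≡ true → Adj G u v ≡ true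
    matching : ∀ u v w → M u v ≡ true → M u w ≡ true → v ≡ w
    induced  : ∀ u v → Covered M u → Covered M v → Adj G u v ≡ true → M u v ≡ true

IsUnionOfInducedMatchings : ∀ {n} (G : SimpleGraph n) (t : ℕ) → (Fin t → EdgeSet n) → Set
IsUnionOfInducedMatchings G t M =
  (∀ i → IsInducedMatching G (M i)) ×
  (∀ u v → Adj G u v ≡ true → ∃[ i ] M i u v ≡ true)

-- integer logarithms used in place of log n and log log n
L₁ : ℕ → ℕ
L₁ n = ⌊log₂ n ⌋

L₂ : ℕ → ℕ
L₂ n = ⌊log₂ ⌊log₂ n ⌋ ⌋

module Submission where

-- Construction (a sphere graph): take the grid [C]^m with C = 2^a, a ≈ L₂ n / 16,
-- and C^m ≤ n < C^(m+1), and join two grid points when ‖x - y‖² = R.  For each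
-- s ∈ [2C]^m the edges xy with x + y = s form an induced matching, because by the
-- parallelogram law x ~ y, x' ~ y', x ~ x' and x + y = x' + y' force x' = y; so
-- t = (2C)^m ≤ n^(1 + 1/a).  For the density, the mean and variance of ‖x - y‖²
-- over all pairs are computed exactly; Chebyshev's inequality puts most pairs in a
-- window of W = 2kC² + 1 values (k ≈ √(8m)), and by pigeonhole some R ≥ 1 is hit by
-- at least 1/(4W) of the C^(2m) pairs.  As C⁸ = O(log n) and m ≤ log n, this gives
-- n² ≤ C² · C^(2m) ≤ 1100 log n · (number of edges).

open import Defs hiding (sym)
open import Data.Nat
  using (ℕ; zero; suc; _+_; _*_; _∸_; _^_; _≤_; _<_; z≤n; s≤s; NonZero; _/_; _%_; _≤ᵇ_; _<ᵇ_; _≡ᵇ_; _≤?_; _<?_; ⌊_/2⌋; ⌈_/2⌉)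
open import Data.Nat.Logarithm using (⌊log₂_⌋; ⌊log₂⌋-mono-≤; ⌊log₂⌊n/2⌋⌋≡⌊log₂n⌋∸1; ⌊log₂[2^n]⌋≡n)
open import Data.Nat.Induction using (<-rec)
open import Data.Nat.Properties hiding (_≤?_; _<?_)
open import Data.Nat.DivMod
open import Data.Nat.Tactic.RingSolver using (solve-∀)
open import Data.Bool using (Bool; true; false; _∧_; if_then_else_; T)
open import Data.Unit using (⊤; tt)
open import Data.Empty using (⊥-elim)
open import Data.Fin using (Fin; toℕ; fromℕ<)
open import Data.Fin.Properties using (toℕ-injective; toℕ-fromℕ<)
open import Data.List using (map; allFin; tabulate)
open import Data.List.Properties using (map-tabulate)
open import Data.Nat.ListAction using (sum)
open import Data.Vec using (Vec; []; _∷_; zipWith)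
open import Data.Product using (∃; ∃-syntax; _×_; _,_; proj₁; proj₂)
open import Data.Sum using (_⊎_; inj₁; inj₂; map₂)
open import Relation.Nullary using (Dec; yes; no; does)
open import Relation.Nullary.Decidable using (dec-true)
open import Data.Bool.Properties using (∧-conicalˡ; ∧-conicalʳ)
import Data.Vec.Properties as Vec
open import Data.Integer as ℤ using (ℤ)
import Data.Integer.Properties as ℤₚ
import Data.Integer.Tactic.RingSolver as ℤ-Solver
open import Relation.Binary.PropositionalEquality
  using (_≡_; refl; sym; trans; cong; cong₂; subst; subst₂; module ≡-Reasoning)

∑ : ℕ → (ℕ → ℕ) → ℕ
∑ zero    f = 0
∑ (suc n) f = f 0 + ∑ n (λ i → f (suc i))

∑-cong< : ∀ n {f g : ℕ → ℕ} → (∀ i → i < n → f i ≡ g i) → ∑ n f ≡ ∑ n g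
∑-cong< zero    e = refl
∑-cong< (suc n) e = cong₂ _+_ (e 0 (s≤s z≤n)) (∑-cong< n (λ i i<n → e (suc i) (s≤s i<n)))

∑-cong : ∀ n {f g : ℕ → ℕ} → (∀ i → f i ≡ g i) → ∑ n f ≡ ∑ n g
∑-cong n e = ∑-cong< n (λ i _ → e i)

∑-mono< : ∀ n {f g : ℕ → ℕ} → (∀ i → i < n → f i ≤ g i) → ∑ n f ≤ ∑ n g
∑-mono< zero    e = z≤n
∑-mono< (suc n) e = +-mono-≤ (e 0 (s≤s z≤n)) (∑-mono< n (λ i i<n → e (suc i) (s≤s i<n)))

∑-mono : ∀ n {f g : ℕ → ℕ} → (∀ i → f i ≤ g i) → ∑ n f ≤ ∑ n g
∑-mono n e = ∑-mono< n (λ i _ → e i)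

∑-split : ∀ a b (f : ℕ → ℕ) → ∑ (a + b) f ≡ ∑ a f + ∑ b (λ i → f (a + i))
∑-split zero    b f = refl
∑-split (suc a) b f = trans (cong (f 0 +_) (∑-split a b (λ i → f (suc i)))) (sym (+-assoc (f 0) _ _))

∑-≤-range : ∀ a n (f : ℕ → ℕ) → a ≤ n → ∑ a f ≤ ∑ n f
∑-≤-range a n f a≤n with m≤n⇒∃[o]m+o≡n a≤n
... | o , refl = subst (∑ a f ≤_) (sym (∑-split a o f)) (m≤m+n _ _)

∑-+ : ∀ n (f g : ℕ → ℕ) → ∑ n (λ i → f i + g i) ≡ ∑ n f + ∑ n g
∑-+ zero    f g = refl
∑-+ (suc n) f g = trans (cong (f 0 + g 0 +_) (∑-+ n (λ i → f (suc i)) (λ i → g (suc i))))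
                        (+-interchange (f 0) (g 0) _ _)
  where
  +-interchange : ∀ a b c d → (a + b) + (c + d) ≡ (a + c) + (b + d)
  +-interchange = solve-∀

∑-* : ∀ n c (f : ℕ → ℕ) → ∑ n (λ i → c * f i) ≡ c * ∑ n f
∑-* zero    c f = sym (*-zeroʳ c)
∑-* (suc n) c f = trans (cong (c * f 0 +_) (∑-* n c (λ i → f (suc i)))) (sym (*-distribˡ-+ c (f 0) _))

∑-const : ∀ n c → ∑ n (λ _ → c) ≡ n * c
∑-const zero    c = refl
∑-const (suc n) c = cong (c +_) (∑-const n c)

∑-swap : ∀ n k (F : ℕ → ℕ → ℕ) → ∑ n (λ i → ∑ k (λ j → F i j)) ≡ ∑ k (λ j → ∑ n (λ i → F i j))
∑-swap zero    k F = sym (trans (∑-const k 0) (*-zeroʳ k))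
∑-swap (suc n) k F = trans (cong (∑ k (F 0) +_) (∑-swap n k (λ i → F (suc i))))
                           (sym (∑-+ k (F 0) (λ j → ∑ n (λ i → F (suc i) j))))

∑-term : ∀ n (f : ℕ → ℕ) i → i < n → f i ≤ ∑ n f
∑-term (suc n) f zero    _         = m≤m+n _ _
∑-term (suc n) f (suc i) (s≤s i<n) = ≤-trans (∑-term n (λ j → f (suc j)) i i<n) (m≤n+m _ (f 0))

argmax : ∀ n (f : ℕ → ℕ) → 0 < n → ∃[ r ] (r < n × (∀ i → i < n → f i ≤ f r))
argmax (suc zero) f _ = 0 , s≤s z≤n , λ { zero _ → ≤-refl ; (suc i) (s≤s ()) }
argmax (suc (suc n)) f _ with argmax (suc n) (λ i → f (suc i)) (s≤s z≤n)
... | r , r<n , max with f 0 ≤? f (suc r)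
...   | yes f0≤ = suc r , s≤s r<n , λ { zero _ → f0≤ ; (suc i) (s≤s i<n) → max i i<n }
...   | no  f0≰ = 0 , s≤s z≤n ,
                  λ { zero _ → ≤-refl ; (suc i) (s≤s i<n) → ≤-trans (max i i<n) (<⇒≤ (≰⇒> f0≰)) }

pigeonhole : ∀ n (f : ℕ → ℕ) → 0 < n → ∃[ r ] (r < n × ∑ n f ≤ n * f r)
pigeonhole n f 0<n with argmax n f 0<n
... | r , r<n , max = r , r<n , ≤-trans (∑-mono< n max) (≤-reflexive (∑-const n (f r)))

-- Base-B digits.  A number i < B ^ m is identified with its vector of m
-- digits; this is how the vertices 0 … C ^ m - 1 become points of the grid [C]^m.
digits : (B : ℕ) → .{{NonZero B}} → (m : ℕ) → ℕ → Vec ℕ m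
digits B zero    i = []
digits B (suc m) i = i % B ∷ digits B m (i / B)

undigits : ∀ {m} → ℕ → Vec ℕ m → ℕ
undigits B []      = 0
undigits B (a ∷ x) = a + undigits B x * B

AllLt : ∀ {m} → ℕ → Vec ℕ m → Set
AllLt B []      = ⊤
AllLt B (a ∷ x) = a < B × AllLt B x

digits-lt : ∀ B .{{_ : NonZero B}} m i → AllLt B (digits B m i)
digits-lt B zero    i = tt
digits-lt B (suc m) i = m%n<n i B , digits-lt B m (i / B)

digits-step : ∀ B .{{_ : NonZero B}} m a i → a < B → digits B (suc m) (a + i * B) ≡ a ∷ digits B m i
digits-step B m a i a<B = cong₂ _∷_ low high
  where
  low : (a + i * B) % B ≡ a
  low = trans ([m+kn]%n≡m%n a i B) (m<n⇒m%n≡m a<B)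
  high : digits B m ((a + i * B) / B) ≡ digits B m i
  high = cong (digits B m) (trans (+-distrib-/ a (i * B) no-carry)
                                  (cong₂ _+_ (m<n⇒m/n≡0 a<B) (m*n/n≡m i B)))
    where
    no-carry : a % B + (i * B) % B < B
    no-carry = subst (_< B) (sym (trans (cong₂ _+_ (m<n⇒m%n≡m a<B) (m*n%n≡0 i B)) (+-identityʳ a))) a<B

digits-undigits : ∀ B .{{_ : NonZero B}} {m} (x : Vec ℕ m) → AllLt B x → digits B m (undigits B x) ≡ x
digits-undigits B []              _          = refl
digits-undigits B {suc m} (a ∷ x) (a<B , x<B) =
  trans (digits-step B m a (undigits B x) a<B) (cong (a ∷_) (digits-undigits B x x<B))

undigits-lt : ∀ B .{{_ : NonZero B}} {m} (x : Vec ℕ m) → AllLt B x → undigits B x < B ^ m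
undigits-lt B []              _           = s≤s z≤n
undigits-lt B {suc m} (a ∷ x) (a<B , x<B) = begin-strict
  a + undigits B x * B  <⟨ +-monoˡ-< (undigits B x * B) a<B ⟩
  suc (undigits B x) * B ≤⟨ *-monoˡ-≤ B (undigits-lt B x x<B) ⟩
  B ^ m * B             ≡⟨ *-comm (B ^ m) B ⟩
  B * B ^ m             ∎
  where open ≤-Reasoning

undigits-digits : ∀ B .{{_ : NonZero B}} m i → i < B ^ m → undigits B (digits B m i) ≡ i
undigits-digits B zero    zero    _        = refl
undigits-digits B zero    (suc i) (s≤s ())
undigits-digits B (suc m) i       i<B^1+m  =
  trans (cong (λ z → i % B + z * B) (undigits-digits B m (i / B) (m<n*o⇒m/o<n i<B^m*B)))
        (sym (m≡m%n+[m/n]*n i B))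
  where
  i<B^m*B : i < B ^ m * B
  i<B^m*B = subst (i <_) (*-comm B (B ^ m)) i<B^1+m

digits-injective : ∀ B .{{_ : NonZero B}} m i j → i < B ^ m → j < B ^ m → digits B m i ≡ digits B m j → i ≡ j
digits-injective B m i j i< j< e =
  trans (sym (undigits-digits B m i i<)) (trans (cong (undigits B) e) (undigits-digits B m j j<))

VecSum : ℕ → (m : ℕ) → (Vec ℕ m → ℕ) → ℕ
VecSum C zero    f = f []
VecSum C (suc m) f = ∑ C (λ a → VecSum C m (λ x → f (a ∷ x)))

∑-by-low-digit : ∀ C M (f : ℕ → ℕ) → ∑ (M * C) f ≡ ∑ M (λ i' → ∑ C (λ a → f (a + i' * C)))
∑-by-low-digit C zero    f = refl
∑-by-low-digit C (suc M) f =
  trans (∑-split C (M * C) f)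
        (cong₂ _+_ (∑-cong C (λ a → cong f (sym (+-identityʳ a))))
                   (trans (∑-by-low-digit C M (λ i → f (C + i)))
                          (∑-cong M (λ i' → ∑-cong C (λ a → cong f (shift a (i' * C)))))))
  where
  shift : ∀ a x → C + (a + x) ≡ a + (C + x)
  shift a x = trans (sym (+-assoc C a x)) (trans (cong (_+ x) (+-comm C a)) (+-assoc a C x))

∑-digits : ∀ C .{{_ : NonZero C}} m (f : Vec ℕ m → ℕ) → ∑ (C ^ m) (λ i → f (digits C m i)) ≡ VecSum C m f
∑-digits C zero    f = +-identityʳ _
∑-digits C (suc m) f = begin
  ∑ (C * C ^ m) (λ i → f (digits C (suc m) i))
    ≡⟨ cong (λ z → ∑ z (λ i → f (digits C (suc m) i))) (*-comm C (C ^ m)) ⟩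
  ∑ (C ^ m * C) (λ i → f (digits C (suc m) i))
    ≡⟨ ∑-by-low-digit C (C ^ m) _ ⟩
  ∑ (C ^ m) (λ i' → ∑ C (λ a → f (digits C (suc m) (a + i' * C))))
    ≡⟨ ∑-cong (C ^ m) (λ i' → ∑-cong< C (λ a a<C → cong f (digits-step C m a i' a<C))) ⟩
  ∑ (C ^ m) (λ i' → ∑ C (λ a → f (a ∷ digits C m i')))
    ≡⟨ ∑-swap (C ^ m) C _ ⟩
  ∑ C (λ a → ∑ (C ^ m) (λ i' → f (a ∷ digits C m i')))
    ≡⟨ ∑-cong C (λ a → ∑-digits C m (λ x → f (a ∷ x))) ⟩
  VecSum C (suc m) f ∎
  where open ≡-Reasoning

VecSum-∑ : ∀ C m k (F : Vec ℕ m → ℕ → ℕ) → VecSum C m (λ x → ∑ k (F x)) ≡ ∑ k (λ j → VecSum C m (λ x → F x j))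
VecSum-∑ C zero    k F = refl
VecSum-∑ C (suc m) k F = trans (∑-cong C (λ a → VecSum-∑ C m k (λ x → F (a ∷ x)))) (∑-swap C k _)

∑∑ : ℕ → (ℕ → ℕ → ℕ) → ℕ
∑∑ C f = ∑ C (λ a → ∑ C (f a))

PairSum : ℕ → (m : ℕ) → (Vec ℕ m → Vec ℕ m → ℕ) → ℕ
PairSum C zero    F = F [] []
PairSum C (suc m) F = ∑∑ C (λ a b → PairSum C m (λ x y → F (a ∷ x) (b ∷ y)))

PairSum-as-VecSum : ∀ C m (F : Vec ℕ m → Vec ℕ m → ℕ) → VecSum C m (λ x → VecSum C m (F x)) ≡ PairSum C m F
PairSum-as-VecSum C zero    F = refl
PairSum-as-VecSum C (suc m) F = ∑-cong C (λ a →
  trans (VecSum-∑ C m C (λ x b → VecSum C m (λ y → F (a ∷ x) (b ∷ y))))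
        (∑-cong C (λ b → PairSum-as-VecSum C m (λ x y → F (a ∷ x) (b ∷ y)))))

∑∑-cong : ∀ C {f g : ℕ → ℕ → ℕ} → (∀ a b → f a b ≡ g a b) → ∑∑ C f ≡ ∑∑ C g
∑∑-cong C e = ∑-cong C (λ a → ∑-cong C (e a))

∑∑-mono< : ∀ C {f g : ℕ → ℕ → ℕ} → (∀ a b → a < C → b < C → f a b ≤ g a b) → ∑∑ C f ≤ ∑∑ C g
∑∑-mono< C e = ∑-mono< C (λ a a<C → ∑-mono< C (λ b b<C → e a b a<C b<C))

∑∑-mono : ∀ C {f g : ℕ → ℕ → ℕ} → (∀ a b → f a b ≤ g a b) → ∑∑ C f ≤ ∑∑ C g
∑∑-mono C e = ∑∑-mono< C (λ a b _ _ → e a b)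

∑∑-+ : ∀ C f g → ∑∑ C (λ a b → f a b + g a b) ≡ ∑∑ C f + ∑∑ C g
∑∑-+ C f g = trans (∑-cong C (λ a → ∑-+ C (f a) (g a))) (∑-+ C _ _)

∑∑-* : ∀ C c f → ∑∑ C (λ a b → c * f a b) ≡ c * ∑∑ C f
∑∑-* C c f = trans (∑-cong C (λ a → ∑-* C c (f a))) (∑-* C c _)

∑∑-const : ∀ C c → ∑∑ C (λ _ _ → c) ≡ (C * C) * c
∑∑-const C c = trans (∑-cong C (λ a → ∑-const C c)) (trans (∑-const C (C * c)) (sym (*-assoc C C c)))

PairSum-cong : ∀ C m {F G : Vec ℕ m → Vec ℕ m → ℕ} → (∀ x y → F x y ≡ G x y) → PairSum C m F ≡ PairSum C m G
PairSum-cong C zero    e = e [] []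
PairSum-cong C (suc m) e = ∑∑-cong C (λ a b → PairSum-cong C m (λ x y → e (a ∷ x) (b ∷ y)))

PairSum-mono : ∀ C m {F G : Vec ℕ m → Vec ℕ m → ℕ} → (∀ x y → F x y ≤ G x y) → PairSum C m F ≤ PairSum C m G
PairSum-mono C zero    e = e [] []
PairSum-mono C (suc m) e = ∑∑-mono C (λ a b → PairSum-mono C m (λ x y → e (a ∷ x) (b ∷ y)))

PairSum-+ : ∀ C m F G → PairSum C m (λ x y → F x y + G x y) ≡ PairSum C m F + PairSum C m G
PairSum-+ C zero    F G = refl
PairSum-+ C (suc m) F G = trans (∑∑-cong C (λ a b → PairSum-+ C m _ _)) (∑∑-+ C _ _)

PairSum-* : ∀ C m c F → PairSum C m (λ x y → c * F x y) ≡ c * PairSum C m F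
PairSum-* C zero    c F = refl
PairSum-* C (suc m) c F = trans (∑∑-cong C (λ a b → PairSum-* C m c _)) (∑∑-* C c _)

PairSum-const : ∀ C m c → PairSum C m (λ _ _ → c) ≡ (C * C) ^ m * c
PairSum-const C zero    c = sym (+-identityʳ c)
PairSum-const C (suc m) c =
  trans (∑∑-cong C (λ a b → PairSum-const C m c)) (trans (∑∑-const C _) (sym (*-assoc (C * C) _ c)))

PairSum-∑ : ∀ C m k (H : ℕ → Vec ℕ m → Vec ℕ m → ℕ) →
            PairSum C m (λ x y → ∑ k (λ r → H r x y)) ≡ ∑ k (λ r → PairSum C m (H r))
PairSum-∑ C m zero    H = trans (PairSum-const C m 0) (*-zeroʳ ((C * C) ^ m))
PairSum-∑ C m (suc k) H =
  trans (PairSum-+ C m _ _) (cong (PairSum C m (H 0) +_) (PairSum-∑ C m k (λ r → H (suc r))))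

-- Squared distances.  sqDiff a b = (a - b)², written with truncated
-- subtraction (one of the two summands is always 0); SqDist x y = ‖x - y‖².
absDiff : ℕ → ℕ → ℕ
absDiff a b = (a ∸ b) + (b ∸ a)

sqDiff : ℕ → ℕ → ℕ
sqDiff a b = (a ∸ b) * (a ∸ b) + (b ∸ a) * (b ∸ a)

SqDist : ∀ {m} → Vec ℕ m → Vec ℕ m → ℕ
SqDist []      []      = 0
SqDist (a ∷ x) (b ∷ y) = sqDiff a b + SqDist x y

sqDiff-≡-absDiff² : ∀ a b → sqDiff a b ≡ absDiff a b * absDiff a b
sqDiff-≡-absDiff² a b with ≤-total a b
... | inj₁ a≤b rewrite m≤n⇒m∸n≡0 a≤b = refl
... | inj₂ b≤a rewrite m≤n⇒m∸n≡0 b≤a | +-identityʳ (a ∸ b) = +-identityʳ _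

absDiff²-+-2ab : ∀ a b → absDiff a b * absDiff a b + 2 * (a * b) ≡ a * a + b * b
absDiff²-+-2ab a b with ≤-total a b
... | inj₁ a≤b with m≤n⇒∃[o]m+o≡n a≤b
...   | k , refl rewrite m≤n⇒m∸n≡0 a≤b | m+n∸m≡n a k = identity a k
  where
  identity : ∀ a k → (0 + k) * (0 + k) + 2 * (a * (a + k)) ≡ a * a + (a + k) * (a + k)
  identity = solve-∀
absDiff²-+-2ab a b | inj₂ b≤a with m≤n⇒∃[o]m+o≡n b≤a
...   | k , refl rewrite m≤n⇒m∸n≡0 b≤a | m+n∸m≡n b k = identity b k
  where
  identity : ∀ b k → (k + 0) * (k + 0) + 2 * ((b + k) * b) ≡ (b + k) * (b + k) + b * b
  identity = solve-∀

sqDiff-sym : ∀ a b → sqDiff a b ≡ sqDiff b a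
sqDiff-sym a b = +-comm ((a ∸ b) * (a ∸ b)) ((b ∸ a) * (b ∸ a))

SqDist-sym : ∀ {m} (x y : Vec ℕ m) → SqDist x y ≡ SqDist y x
SqDist-sym []      []      = refl
SqDist-sym (a ∷ x) (b ∷ y) = cong₂ _+_ (sqDiff-sym a b) (SqDist-sym x y)

SqDist-diag : ∀ {m} (x : Vec ℕ m) → SqDist x x ≡ 0
SqDist-diag []      = refl
SqDist-diag (a ∷ x) rewrite n∸n≡0 a = SqDist-diag x

sqDiff≡0⇒≡ : ∀ a b → sqDiff a b ≡ 0 → a ≡ b
sqDiff≡0⇒≡ a b e =
  ≤-antisym (m∸n≡0⇒m≤n (square≡0 (a ∸ b) (m+n≡0⇒m≡0 _ e)))
            (m∸n≡0⇒m≤n (square≡0 (b ∸ a) (m+n≡0⇒n≡0 _ e)))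
  where
  square≡0 : ∀ w → w * w ≡ 0 → w ≡ 0
  square≡0 zero _ = refl

sqDiff-bound : ∀ C a b → a < C → b < C → sqDiff a b ≤ 2 * (C * C)
sqDiff-bound C a b a<C b<C = subst (sqDiff a b ≤_) (cong (C * C +_) (sym (+-identityʳ (C * C))))
  (+-mono-≤ (square-mono (≤-trans (m∸n≤m a b) (<⇒≤ a<C))) (square-mono (≤-trans (m∸n≤m b a) (<⇒≤ b<C))))
  where
  square-mono : ∀ {u v} → u ≤ v → u * u ≤ v * v
  square-mono u≤v = *-mono-≤ u≤v u≤v

-- With D = C² pairs per coordinate, s = ∑_{a,b<C} (a-b)² and s₂ = ∑_{a,b<C} (a-b)⁴,
-- the coordinates are independent, so (writing P = D ^ m for the number of pairs)
--   ∑ ‖x-y‖²  = m s P / D,    ∑ ‖x-y‖⁴ = P (m D s₂ + m (m-1) s²) / D².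
module Moments (C : ℕ) where
  D : ℕ
  D = C * C

  Pairs : ℕ → ℕ
  Pairs m = D ^ m

  s s₂ : ℕ
  s  = ∑∑ C sqDiff
  s₂ = ∑∑ C (λ a b → sqDiff a b * sqDiff a b)

  PairSum-step : ∀ m (g : ℕ → ℕ → ℕ) (H : Vec ℕ m → Vec ℕ m → ℕ) →
    ∑∑ C (λ a b → PairSum C m (λ x y → g a b + H x y)) ≡ Pairs m * ∑∑ C g + D * PairSum C m H
  PairSum-step m g H = begin
    ∑∑ C (λ a b → PairSum C m (λ x y → g a b + H x y))
      ≡⟨ ∑∑-cong C (λ a b → trans (PairSum-+ C m _ _) (cong (_+ PairSum C m H) (PairSum-const C m (g a b)))) ⟩
    ∑∑ C (λ a b → Pairs m * g a b + PairSum C m H)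
      ≡⟨ ∑∑-+ C _ _ ⟩
    ∑∑ C (λ a b → Pairs m * g a b) + ∑∑ C (λ a b → PairSum C m H)
      ≡⟨ cong₂ _+_ (∑∑-* C (Pairs m) g) (∑∑-const C _) ⟩
    Pairs m * ∑∑ C g + D * PairSum C m H ∎
    where open ≡-Reasoning

  first-moment : ∀ m → D * PairSum C m SqDist ≡ m * s * Pairs m
  first-moment zero    = *-zeroʳ D
  first-moment (suc m) = begin
    D * PairSum C (suc m) SqDist                     ≡⟨ cong (D *_) (PairSum-step m sqDiff SqDist) ⟩
    D * (Pairs m * s + D * PairSum C m SqDist)       ≡⟨ *-distribˡ-+ D (Pairs m * s) _ ⟩
    D * (Pairs m * s) + D * (D * PairSum C m SqDist) ≡⟨ cong (λ z → D * (Pairs m * s) + D * z) (first-moment m) ⟩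
    D * (Pairs m * s) + D * (m * s * Pairs m)        ≡⟨ normalise D (Pairs m) s m ⟩
    suc m * s * (D * Pairs m)                        ∎
    where
    open ≡-Reasoning
    normalise : ∀ D P s m → D * (P * s) + D * (m * s * P) ≡ (1 + m) * s * (D * P)
    normalise = solve-∀

  PairSum-square-step : ∀ m (g : ℕ → ℕ → ℕ) (H : Vec ℕ m → Vec ℕ m → ℕ) →
    ∑∑ C (λ a b → PairSum C m (λ x y → (g a b + H x y) * (g a b + H x y)))
      ≡ Pairs m * ∑∑ C (λ a b → g a b * g a b) + 2 * ∑∑ C g * PairSum C m H
        + D * PairSum C m (λ x y → H x y * H x y)
  PairSum-square-step m g H = begin
    ∑∑ C (λ a b → PairSum C m (λ x y → (g a b + H x y) * (g a b + H x y)))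
      ≡⟨ ∑∑-cong C (λ a b → PairSum-cong C m (λ x y → square-+ (g a b) (H x y))) ⟩
    ∑∑ C (λ a b → PairSum C m (λ x y → g a b * g a b + (2 * g a b * H x y + H x y * H x y)))
      ≡⟨ ∑∑-cong C (λ a b → trans (PairSum-+ C m _ _) (cong₂ _+_ (PairSum-const C m _) (inner a b))) ⟩
    ∑∑ C (λ a b → Pairs m * (g a b * g a b) + (2 * g a b * PH + PH²))
      ≡⟨ trans (∑∑-+ C _ _) (cong₂ _+_ (∑∑-* C (Pairs m) _) (trans (∑∑-+ C _ _) (cong₂ _+_ cross (∑∑-const C _)))) ⟩
    Pairs m * ∑∑ C (λ a b → g a b * g a b) + (2 * ∑∑ C g * PH + D * PH²)
      ≡⟨ sym (+-assoc (Pairs m * ∑∑ C (λ a b → g a b * g a b)) _ _) ⟩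
    Pairs m * ∑∑ C (λ a b → g a b * g a b) + 2 * ∑∑ C g * PH + D * PH² ∎
    where
    open ≡-Reasoning
    PH PH² : ℕ
    PH  = PairSum C m H
    PH² = PairSum C m (λ x y → H x y * H x y)
    square-+ : ∀ g h → (g + h) * (g + h) ≡ g * g + (2 * g * h + h * h)
    square-+ = solve-∀
    inner : ∀ a b → PairSum C m (λ x y → 2 * g a b * H x y + H x y * H x y) ≡ 2 * g a b * PH + PH²
    inner a b = trans (PairSum-+ C m _ _) (cong (_+ PH²) (PairSum-* C m (2 * g a b) H))
    cross : ∑∑ C (λ a b → 2 * g a b * PH) ≡ 2 * ∑∑ C g * PH
    cross = trans (∑∑-cong C (λ a b → *-comm (2 * g a b) PH))
           (trans (∑∑-* C PH (λ a b → 2 * g a b))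
           (trans (cong (PH *_) (∑∑-* C 2 g)) (*-comm PH (2 * ∑∑ C g))))

  fourth : ℕ → ℕ
  fourth m = PairSum C m (λ x y → SqDist x y * SqDist x y)

  second-moment : ∀ m → D * D * fourth m + m * Pairs m * (s * s)
                        ≡ Pairs m * (m * D * s₂ + m * m * (s * s))
  second-moment zero    = trans (+-identityʳ (D * D * 0)) (*-zeroʳ (D * D))
  second-moment (suc m) =
    induction-step D (Pairs m) s s₂ m (PairSum C m SqDist) (fourth m) (fourth (suc m))
                   (first-moment m) (second-moment m) (PairSum-square-step m sqDiff SqDist)
    where
    induction-step : ∀ D P s s₂ m P₁ P₂ P₂' → D * P₁ ≡ m * s * P →
      D * D * P₂ + m * P * (s * s) ≡ P * (m * D * s₂ + m * m * (s * s)) →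
      P₂' ≡ P * s₂ + 2 * s * P₁ + D * P₂ →
      D * D * P₂' + (1 + m) * (D * P) * (s * s) ≡ (D * P) * ((1 + m) * D * s₂ + (1 + m) * (1 + m) * (s * s))
    induction-step D P s s₂ m P₁ P₂ P₂' e₁ e₂ refl = +-cancelʳ-≡ (D * (m * P * (s * s))) _ _ (begin
        D * D * (P * s₂ + 2 * s * P₁ + D * P₂) + (1 + m) * (D * P) * (s * s) + D * (m * P * (s * s))
          ≡⟨ regroup D P s s₂ m P₁ P₂ ⟩
        D * D * P * s₂ + 2 * s * D * (D * P₁) + D * (D * D * P₂ + m * P * (s * s)) + (1 + m) * (D * P) * (s * s)
          ≡⟨ cong₂ (λ u v → D * D * P * s₂ + 2 * s * D * u + D * v + (1 + m) * (D * P) * (s * s)) e₁ e₂ ⟩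
        D * D * P * s₂ + 2 * s * D * (m * s * P) + D * (P * (m * D * s₂ + m * m * (s * s))) + (1 + m) * (D * P) * (s * s)
          ≡⟨ collect D P s s₂ m ⟩
        (D * P) * ((1 + m) * D * s₂ + (1 + m) * (1 + m) * (s * s)) + D * (m * P * (s * s)) ∎)
      where
      open ≡-Reasoning
      regroup : ∀ D P s s₂ m P₁ P₂ →
        D * D * (P * s₂ + 2 * s * P₁ + D * P₂) + (1 + m) * (D * P) * (s * s) + D * (m * P * (s * s))
          ≡ D * D * P * s₂ + 2 * s * D * (D * P₁) + D * (D * D * P₂ + m * P * (s * s)) + (1 + m) * (D * P) * (s * s)
      regroup = solve-∀
      collect : ∀ D P s s₂ m →
        D * D * P * s₂ + 2 * s * D * (m * s * P) + D * (P * (m * D * s₂ + m * m * (s * s))) + (1 + m) * (D * P) * (s * s)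
          ≡ (D * P) * ((1 + m) * D * s₂ + (1 + m) * (1 + m) * (s * s)) + D * (m * P * (s * s))
      collect = solve-∀

𝟙 : Bool → ℕ
𝟙 true  = 1
𝟙 false = 0

𝟙-T : ∀ {b} → T b → 𝟙 b ≡ 1
𝟙-T {true} _ = refl

T⇒≡true : ∀ {b} → T b → b ≡ true
T⇒≡true {true} _ = refl

≡true⇒T : ∀ {b} → b ≡ true → T b
≡true⇒T refl = tt

≡ᵇ-refl : ∀ v → (v ≡ᵇ v) ≡ true
≡ᵇ-refl zero    = refl
≡ᵇ-refl (suc v) = ≡ᵇ-refl v

∑-𝟙-≡ᵇ : ∀ n a → ∑ n (λ b → 𝟙 (a ≡ᵇ b)) ≤ 1
∑-𝟙-≡ᵇ zero    a       = z≤n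
∑-𝟙-≡ᵇ (suc n) zero    = ≤-reflexive (cong suc (trans (∑-cong n (λ _ → refl)) (trans (∑-const n 0) (*-zeroʳ n))))
∑-𝟙-≡ᵇ (suc n) (suc a) = ∑-𝟙-≡ᵇ n a

private
  <+-+-pos : ∀ a t L → 1 ≤ L → a < a + t + L
  <+-+-pos a t L 1≤L = ≤-trans (s≤s (m≤m+n a t)) (subst (_≤ a + t + L) (+-comm (a + t) 1) (+-monoʳ-≤ (a + t) 1≤L))

absDiff-< : ∀ a b L → absDiff a b < L → a < b + L × b < a + L
absDiff-< a b L d<L with ≤-total a b
... | inj₁ a≤b with m≤n⇒∃[o]m+o≡n a≤b
...   | t , refl rewrite m≤n⇒m∸n≡0 a≤b | m+n∸m≡n a t = <+-+-pos a t L (≤-trans (s≤s z≤n) d<L) , +-monoʳ-< a d<L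
absDiff-< a b L d<L | inj₂ b≤a with m≤n⇒∃[o]m+o≡n b≤a
...   | t , refl rewrite m≤n⇒m∸n≡0 b≤a | m+n∸m≡n b t | +-identityʳ t = +-monoʳ-< b d<L , <+-+-pos b t L (≤-trans (s≤s z≤n) d<L)

window : ∀ D .{{_ : NonZero D}} v μ k → absDiff (D * v) μ < k * (D * D) →
         (μ ∸ k * (D * D)) / D ≤ v × v < (μ ∸ k * (D * D)) / D + (2 * k * D + 1)
window D v μ k close = lower , upper
  where
  Λ L lo : ℕ
  Λ  = k * (D * D)
  L  = μ ∸ Λ
  lo = L / D
  near : D * v < μ + Λ × μ < D * v + Λ
  near = absDiff-< (D * v) μ Λ close
  lower : lo ≤ v
  lower = *-cancelʳ-≤ lo v D (≤-trans (m/n*n≤m L D) (subst (L ≤_) (*-comm D v)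
            (m≤n+o⇒m∸n≤o μ Λ (subst (μ ≤_) (+-comm (D * v) Λ) (<⇒≤ (proj₂ near))))))
  L< : L < D + lo * D
  L< = subst (_< D + lo * D) (sym (m≡m%n+[m/n]*n L D)) (+-monoˡ-< (lo * D) (m%n<n L D))
  Dv< : D * v < Λ + (D + lo * D) + Λ
  Dv< = <-≤-trans (proj₁ near) (+-monoˡ-≤ Λ (≤-trans (m≤n+m∸n μ Λ) (+-monoʳ-≤ Λ (<⇒≤ L<))))
  upper : v < lo + (2 * k * D + 1)
  upper = *-cancelʳ-< D v (lo + (2 * k * D + 1)) (subst₂ _<_ (*-comm D v) (normalise k D lo) Dv<)
    where
    normalise : ∀ k D lo → k * (D * D) + (D + lo * D) + k * (D * D) ≡ (lo + (2 * k * D + 1)) * D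
    normalise = solve-∀

-- If the t pairs split into b far, g good and z coincident ones, with at most
-- half far and at most a quarter coincident, then a quarter of them are good.
quarter-remains : ∀ t b g z c w → t ≤ b + g + z → 2 * b ≤ t → z ≤ c → 4 * c ≤ t → g ≤ w → t ≤ 4 * w
quarter-remains t b g z c w split far-few z≤c c-few g≤w = ≤-trans t≤4g (*-monoʳ-≤ 4 g≤w)
  where
  open ≤-Reasoning
  t≤2g+2c : t ≤ 2 * g + 2 * c
  t≤2g+2c = +-cancelˡ-≤ t _ _ (begin
    t + t                      ≤⟨ +-mono-≤ split split ⟩
    (b + g + z) + (b + g + z)  ≡⟨ double b g z ⟩
    2 * b + (2 * g + 2 * z)    ≤⟨ +-mono-≤ far-few (+-monoʳ-≤ (2 * g) (*-monoʳ-≤ 2 z≤c)) ⟩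
    t + (2 * g + 2 * c)        ∎)
    where
    double : ∀ b g z → (b + g + z) + (b + g + z) ≡ 2 * b + (2 * g + 2 * z)
    double = solve-∀
  t≤4g : t ≤ 4 * g
  t≤4g = +-cancelʳ-≤ t _ _ (begin
    t + t                               ≤⟨ +-mono-≤ t≤2g+2c t≤2g+2c ⟩
    (2 * g + 2 * c) + (2 * g + 2 * c)   ≡⟨ double g c ⟩
    4 * g + 4 * c                       ≤⟨ +-monoʳ-≤ (4 * g) c-few ⟩
    4 * g + t                           ∎)
    where
    double : ∀ g c → (2 * g + 2 * c) + (2 * g + 2 * c) ≡ 4 * g + 4 * c
    double = solve-∀

-- Concentration of ‖x - y‖² for pairs of points of [C]^m (C ≥ 1): by Chebyshev,
-- for most pairs D·‖x - y‖² is within k D² of its mean m s, so ‖x - y‖² lies in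
-- a window of W = 2kD + 1 values, and one value R ≥ 1 in it is hit by ≥ 1/(4W) of all pairs.
module Concentration (c : ℕ) where
  C : ℕ
  C = suc c

  open Moments C public

  s₂-bound : s₂ ≤ D * ((2 * D) * (2 * D))
  s₂-bound = ≤-trans (∑∑-mono< C (λ a b a<C b<C → *-mono-≤ (sqDiff-bound C a b a<C b<C) (sqDiff-bound C a b a<C b<C)))
                     (≤-reflexive (∑∑-const C _))

  -- distance of D·‖x - y‖² from its mean m s
  deviation : ∀ m → Vec ℕ m → Vec ℕ m → ℕ
  deviation m x y = absDiff (D * SqDist x y) (m * s)

  variance : ℕ → ℕ
  variance m = PairSum C m (λ x y → deviation m x y * deviation m x y)

  variance-identity : ∀ m → variance m + m * Pairs m * (s * s) ≡ Pairs m * m * D * s₂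
  variance-identity m =
    combine (variance m) D (PairSum C m SqDist) (fourth m) (Pairs m) s s₂ m expand (first-moment m) (second-moment m)
    where
    expand : variance m + (2 * (m * s) * D) * PairSum C m SqDist ≡ D * D * fourth m + Pairs m * ((m * s) * (m * s))
    expand = begin
      variance m + (2 * (m * s) * D) * PairSum C m SqDist
        ≡⟨ cong (variance m +_) (sym (PairSum-* C m (2 * (m * s) * D) SqDist)) ⟩
      variance m + PairSum C m (λ x y → (2 * (m * s) * D) * SqDist x y)
        ≡⟨ sym (PairSum-+ C m _ _) ⟩
      PairSum C m (λ x y → deviation m x y * deviation m x y + (2 * (m * s) * D) * SqDist x y)
        ≡⟨ PairSum-cong C m (λ x y → trans (cong (deviation m x y * deviation m x y +_) (reorder (m * s) D (SqDist x y)))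
                                           (absDiff²-+-2ab (D * SqDist x y) (m * s))) ⟩
      PairSum C m (λ x y → (D * SqDist x y) * (D * SqDist x y) + (m * s) * (m * s))
        ≡⟨ PairSum-+ C m _ _ ⟩
      PairSum C m (λ x y → (D * SqDist x y) * (D * SqDist x y)) + PairSum C m (λ x y → (m * s) * (m * s))
        ≡⟨ cong₂ _+_ (trans (PairSum-cong C m (λ x y → square-* D (SqDist x y))) (PairSum-* C m (D * D) _))
                     (PairSum-const C m _) ⟩
      D * D * fourth m + Pairs m * ((m * s) * (m * s)) ∎
      where
      open ≡-Reasoning
      reorder : ∀ u D x → (2 * u * D) * x ≡ 2 * ((D * x) * u)
      reorder = solve-∀
      square-* : ∀ D x → (D * x) * (D * x) ≡ D * D * (x * x)
      square-* = solve-∀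
    -- Var = E[X²] - E[X]², as a polynomial identity in the moments
    combine : ∀ V D P₁ P₂ P s s₂ m → V + (2 * (m * s) * D) * P₁ ≡ D * D * P₂ + P * ((m * s) * (m * s)) →
              D * P₁ ≡ m * s * P → D * D * P₂ + m * P * (s * s) ≡ P * (m * D * s₂ + m * m * (s * s)) →
              V + m * P * (s * s) ≡ P * m * D * s₂
    combine V D P₁ P₂ P s s₂ m e e₁ e₂ = +-cancelʳ-≡ (2 * (m * s) * (D * P₁)) _ _ (begin
      V + m * P * (s * s) + 2 * (m * s) * (D * P₁)              ≡⟨ r₁ V m P s D P₁ ⟩
      (V + (2 * (m * s) * D) * P₁) + m * P * (s * s)            ≡⟨ cong (_+ m * P * (s * s)) e ⟩
      D * D * P₂ + P * ((m * s) * (m * s)) + m * P * (s * s)    ≡⟨ r₂ D P₂ P m s ⟩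
      (D * D * P₂ + m * P * (s * s)) + P * ((m * s) * (m * s))  ≡⟨ cong (_+ P * ((m * s) * (m * s))) e₂ ⟩
      P * (m * D * s₂ + m * m * (s * s)) + P * ((m * s) * (m * s)) ≡⟨ r₃ P m D s₂ s ⟩
      P * m * D * s₂ + 2 * (m * s) * (m * s * P)                ≡⟨ cong (λ z → P * m * D * s₂ + 2 * (m * s) * z) (sym e₁) ⟩
      P * m * D * s₂ + 2 * (m * s) * (D * P₁)                   ∎)
      where
      open ≡-Reasoning
      r₁ : ∀ V m P s D P₁ → V + m * P * (s * s) + 2 * (m * s) * (D * P₁) ≡ (V + (2 * (m * s) * D) * P₁) + m * P * (s * s)
      r₁ = solve-∀
      r₂ : ∀ D P₂ P m s → D * D * P₂ + P * ((m * s) * (m * s)) + m * P * (s * s) ≡ (D * D * P₂ + m * P * (s * s)) + P * ((m * s) * (m * s))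
      r₂ = solve-∀
      r₃ : ∀ P m D s₂ s → P * (m * D * s₂ + m * m * (s * s)) + P * ((m * s) * (m * s)) ≡ P * m * D * s₂ + 2 * (m * s) * (m * s * P)
      r₃ = solve-∀

  variance-bound : ∀ m → variance m ≤ Pairs m * m * D * (D * ((2 * D) * (2 * D)))
  variance-bound m = ≤-trans (m≤m+n (variance m) _)
                     (≤-trans (≤-reflexive (variance-identity m)) (*-monoʳ-≤ (Pairs m * m * D) s₂-bound))

  far : ℕ → ∀ m → Vec ℕ m → Vec ℕ m → ℕ
  far Λ m x y = 𝟙 (Λ ≤ᵇ deviation m x y)

  far-≤-deviation² : ∀ Λ m x y → Λ * Λ * far Λ m x y ≤ deviation m x y * deviation m x y
  far-≤-deviation² Λ m x y with Λ ≤ᵇ deviation m x y in eq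
  ... | true  = subst (_≤ deviation m x y * deviation m x y) (sym (*-identityʳ (Λ * Λ)))
                      (*-mono-≤ Λ≤dev Λ≤dev)
    where
    Λ≤dev : Λ ≤ deviation m x y
    Λ≤dev = ≤ᵇ⇒≤ Λ (deviation m x y) (≡true⇒T eq)
  ... | false = subst (_≤ deviation m x y * deviation m x y) (sym (*-zeroʳ (Λ * Λ))) z≤n

  chebyshev : ∀ m' k → 8 * suc m' ≤ k * k → 2 * PairSum C (suc m') (far (k * (D * D)) (suc m')) ≤ Pairs (suc m')
  chebyshev m' k k²-large = *-cancelʳ-≤ _ _ (4 * m * (D * D * (D * D))) (begin
      2 * F * (4 * m * (D * D * (D * D)))          ≡⟨ r₁ F m D ⟩
      (8 * m) * (D * D * (D * D)) * F              ≤⟨ *-monoˡ-≤ F (*-monoˡ-≤ (D * D * (D * D)) k²-large) ⟩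
      (k * k) * (D * D * (D * D)) * F              ≡⟨ r₂ k D F ⟩
      Λ * Λ * F                                    ≡⟨ sym (PairSum-* C m (Λ * Λ) (far Λ m)) ⟩
      PairSum C m (λ x y → Λ * Λ * far Λ m x y)    ≤⟨ PairSum-mono C m (far-≤-deviation² Λ m) ⟩
      variance m                                   ≤⟨ variance-bound m ⟩
      Pairs m * m * D * (D * ((2 * D) * (2 * D)))  ≡⟨ r₃ (Pairs m) m D ⟩
      Pairs m * (4 * m * (D * D * (D * D)))        ∎)
    where
    open ≤-Reasoning
    m Λ F : ℕ
    m = suc m'
    Λ = k * (D * D)
    F = PairSum C m (far Λ m)
    r₁ : ∀ F m D → 2 * F * (4 * m * (D * D * (D * D))) ≡ (8 * m) * (D * D * (D * D)) * F
    r₁ = solve-∀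
    r₂ : ∀ k D F → (k * k) * (D * D * (D * D)) * F ≡ (k * (D * D)) * (k * (D * D)) * F
    r₂ = solve-∀
    r₃ : ∀ P m D → P * m * D * (D * ((2 * D) * (2 * D))) ≡ P * (4 * m * (D * D * (D * D)))
    r₃ = solve-∀

  coincide : ∀ {m} → Vec ℕ m → Vec ℕ m → ℕ
  coincide x y = 𝟙 (SqDist x y ≡ᵇ 0)

  coincide-∷ : ∀ {m} a b (x y : Vec ℕ m) → coincide (a ∷ x) (b ∷ y) ≤ 𝟙 (a ≡ᵇ b) * coincide x y
  coincide-∷ a b x y with sqDiff a b + SqDist x y ≡ᵇ 0 in eq
  ... | false = z≤n
  ... | true  = ≤-reflexive (sym (cong₂ _*_ (𝟙-T (≡⇒≡ᵇ a b (sqDiff≡0⇒≡ a b (m+n≡0⇒m≡0 (sqDiff a b) total≡0))))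
                                            (𝟙-T (≡⇒≡ᵇ (SqDist x y) 0 (m+n≡0⇒n≡0 (sqDiff a b) total≡0)))))
    where
    total≡0 : sqDiff a b + SqDist x y ≡ 0
    total≡0 = ≡ᵇ⇒≡ _ 0 (≡true⇒T eq)

  coincide-count : ∀ m → PairSum C m coincide ≤ C ^ m
  coincide-count zero    = ≤-refl
  coincide-count (suc m) = begin
    PairSum C (suc m) coincide
      ≤⟨ ∑∑-mono C (λ a b → PairSum-mono C m (coincide-∷ a b)) ⟩
    ∑∑ C (λ a b → PairSum C m (λ x y → 𝟙 (a ≡ᵇ b) * coincide x y))
      ≡⟨ ∑∑-cong C (λ a b → trans (PairSum-* C m (𝟙 (a ≡ᵇ b)) coincide) (*-comm (𝟙 (a ≡ᵇ b)) Z)) ⟩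
    ∑ C (λ a → ∑ C (λ b → Z * 𝟙 (a ≡ᵇ b)))
      ≡⟨ ∑-cong C (λ a → ∑-* C Z (λ b → 𝟙 (a ≡ᵇ b))) ⟩
    ∑ C (λ a → Z * ∑ C (λ b → 𝟙 (a ≡ᵇ b)))
      ≤⟨ ∑-mono C (λ a → *-monoʳ-≤ Z (∑-𝟙-≡ᵇ C a)) ⟩
    ∑ C (λ a → Z * 1)
      ≡⟨ trans (∑-const C _) (cong (C *_) (*-identityʳ Z)) ⟩
    C * Z
      ≤⟨ *-monoʳ-≤ C (coincide-count m) ⟩
    C * C ^ m ∎
    where
    open ≤-Reasoning
    Z : ℕ
    Z = PairSum C m coincide

  sphere-count : ∀ m → ℕ → ℕ
  sphere-count m R = PairSum C m (λ x y → 𝟙 (SqDist x y ≡ᵇ R))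

  private
    module Window (m' k : ℕ) where
      m Λ lo W : ℕ
      m  = suc m'
      Λ  = k * (D * D)
      lo = (m * s ∸ Λ) / D
      W  = 2 * k * D + 1

      good : Vec ℕ m → Vec ℕ m → ℕ
      good x y = if Λ ≤ᵇ deviation m x y then 0 else 𝟙 (1 ≤ᵇ SqDist x y)

      shell : ℕ → Vec ℕ m → Vec ℕ m → ℕ
      shell r x y = if 1 ≤ᵇ lo + r then 𝟙 (SqDist x y ≡ᵇ lo + r) else 0

      far-good-coincide : ∀ x y → 1 ≤ far Λ m x y + good x y + coincide x y
      far-good-coincide x y with Λ ≤ᵇ deviation m x y
      ... | true = s≤s z≤n
      ... | false with SqDist x y
      ...   | zero  = s≤s z≤n
      ...   | suc _ = s≤s z≤n

      in-window : ∀ x y v → SqDist x y ≡ v → lo ≤ v → v < lo + W → 𝟙 (1 ≤ᵇ v) ≤ ∑ W (λ r → shell r x y)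
      in-window x y zero    _  _    _    = z≤n
      in-window x y (suc v) eq lo≤v v<hi = ≤-trans (≤-reflexive (sym shell≡1)) (∑-term W (λ r → shell r x y) r r<W)
        where
        r : ℕ
        r = suc v ∸ lo
        lo+r≡v : lo + r ≡ suc v
        lo+r≡v = m+[n∸m]≡n lo≤v
        r<W : r < W
        r<W = +-cancelˡ-< lo r W (subst (_< lo + W) (sym lo+r≡v) v<hi)
        shell≡1 : shell r x y ≡ 1
        shell≡1 rewrite lo+r≡v | eq | ≡ᵇ-refl v = refl

      good-≤-shells : ∀ x y → good x y ≤ ∑ W (λ r → shell r x y)
      good-≤-shells x y with Λ ≤ᵇ deviation m x y in eq
      ... | true  = z≤n
      ... | false = in-window x y (SqDist x y) refl (proj₁ bounds) (proj₂ bounds)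
        where
        bounds : lo ≤ SqDist x y × SqDist x y < lo + W
        bounds = window D (SqDist x y) (m * s) k (≰⇒> (λ Λ≤ → subst T eq (≤⇒≤ᵇ Λ≤)))

      pairs-split : Pairs m ≤ PairSum C m (far Λ m) + PairSum C m good + PairSum C m coincide
      pairs-split = begin
        Pairs m                                   ≡⟨ sym (trans (PairSum-const C m 1) (*-identityʳ (Pairs m))) ⟩
        PairSum C m (λ _ _ → 1)                   ≤⟨ PairSum-mono C m far-good-coincide ⟩
        PairSum C m (λ x y → far Λ m x y + good x y + coincide x y)
          ≡⟨ trans (PairSum-+ C m (λ x y → far Λ m x y + good x y) coincide) (cong (_+ PairSum C m coincide) (PairSum-+ C m (far Λ m) good)) ⟩
        PairSum C m (far Λ m) + PairSum C m good + PairSum C m coincide ∎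
        where open ≤-Reasoning

      shell-as-sphere : ∀ R → (1 ≤ᵇ R) ≡ true → ∀ r → lo + r ≡ R → PairSum C m (shell r) ≡ sphere-count m R
      shell-as-sphere R pos r refl = PairSum-cong C m (λ x y → cong (λ b → if b then 𝟙 (SqDist x y ≡ᵇ R) else 0) pos)

      empty-shell : ∀ r → (1 ≤ᵇ lo + r) ≡ false → PairSum C m (shell r) ≡ 0
      empty-shell r zero-radius = trans (PairSum-cong C m (λ x y → cong (λ b → if b then 𝟙 (SqDist x y ≡ᵇ lo + r) else 0) zero-radius))
                                        (trans (PairSum-const C m 0) (*-zeroʳ (Pairs m)))

  popular-radius : ∀ m' k → 8 * suc m' ≤ k * k → 4 * C ^ suc m' ≤ Pairs (suc m') →
    ∃[ R ] (1 ≤ R × Pairs (suc m') ≤ 4 * (2 * k * D + 1) * sphere-count (suc m') R)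
  popular-radius m' k k²-large grid-large = choose (1 ≤ᵇ lo + r₀) refl
    where
    open Window m' k
    fullest-shell : ∃[ r ] (r < W × ∑ W (λ r → PairSum C m (shell r)) ≤ W * PairSum C m (shell r))
    fullest-shell = pigeonhole W (λ r → PairSum C m (shell r)) (m≤n+m 1 (2 * k * D))
    r₀ : ℕ
    r₀ = proj₁ fullest-shell
    popular : ∑ W (λ r → PairSum C m (shell r)) ≤ W * PairSum C m (shell r₀)
    popular = proj₂ (proj₂ fullest-shell)
    good≤ : PairSum C m good ≤ W * PairSum C m (shell r₀)
    good≤ = ≤-trans (PairSum-mono C m good-≤-shells) (≤-trans (≤-reflexive (PairSum-∑ C m W shell)) popular)
    many : Pairs m ≤ 4 * (W * PairSum C m (shell r₀))
    many = quarter-remains (Pairs m) (PairSum C m (far Λ m)) (PairSum C m good) (PairSum C m coincide)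
                           (C ^ m) (W * PairSum C m (shell r₀)) pairs-split (chebyshev m' k k²-large)
                           (coincide-count m) grid-large good≤
    choose : ∀ b → (1 ≤ᵇ lo + r₀) ≡ b → ∃[ R ] (1 ≤ R × Pairs m ≤ 4 * W * sphere-count m R)
    choose true  pos  = lo + r₀ , ≤ᵇ⇒≤ 1 (lo + r₀) (≡true⇒T pos) ,
      subst (Pairs m ≤_) (trans (cong (λ z → 4 * (W * z)) (shell-as-sphere (lo + r₀) pos r₀ refl)) (sym (*-assoc 4 W _))) many
    choose false no-radius = ⊥-elim (<⇒≱ (m^n>0 D m)
      (≤-trans many (≤-reflexive (trans (cong (λ z → 4 * (W * z)) (empty-shell r₀ no-radius)) (cong (4 *_) (*-zeroʳ W))))))

_+ᵛ_ : ∀ {m} → Vec ℕ m → Vec ℕ m → Vec ℕ m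
_+ᵛ_ = zipWith _+_

∷-injective : ∀ {m} {a b : ℕ} {x y : Vec ℕ m} → _≡_ {A = Vec ℕ (suc m)} (a ∷ x) (b ∷ y) → a ≡ b × x ≡ y
∷-injective refl = refl , refl

+ᵛ-comm : ∀ {m} (x y : Vec ℕ m) → x +ᵛ y ≡ y +ᵛ x
+ᵛ-comm []      []      = refl
+ᵛ-comm (a ∷ x) (b ∷ y) = cong₂ _∷_ (+-comm a b) (+ᵛ-comm x y)

+ᵛ-cancelˡ : ∀ {m} (x y z : Vec ℕ m) → x +ᵛ y ≡ x +ᵛ z → y ≡ z
+ᵛ-cancelˡ []      []      []      _ = refl
+ᵛ-cancelˡ (a ∷ x) (b ∷ y) (c ∷ z) e with ∷-injective e
... | e₁ , e₂ = cong₂ _∷_ (+-cancelˡ-≡ a b c e₁) (+ᵛ-cancelˡ x y z e₂)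

+ᵛ-lt : ∀ {m} C (x y : Vec ℕ m) → AllLt C x → AllLt C y → AllLt (C + C) (x +ᵛ y)
+ᵛ-lt C []      []      _           _           = tt
+ᵛ-lt C (a ∷ x) (b ∷ y) (a<C , x<C) (b<C , y<C) = +-mono-< a<C b<C , +ᵛ-lt C x y x<C y<C

sq : ℤ → ℤ → ℤ
sq u v = (u ℤ.- v) ℤ.* (u ℤ.- v)

sqDiff-ℤ : ∀ a b → ℤ.+ sqDiff a b ≡ sq (ℤ.+ a) (ℤ.+ b)
sqDiff-ℤ a b = trans (cong ℤ.+_ (sqDiff-≡-absDiff² a b)) (absDiff²-ℤ a b)
  where
  absDiff²-ℤ : ∀ a b → ℤ.+ (absDiff a b * absDiff a b) ≡ sq (ℤ.+ a) (ℤ.+ b)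
  absDiff²-ℤ a b with ≤-total a b
  ... | inj₁ a≤b with m≤n⇒∃[o]m+o≡n a≤b
  ...   | t , refl rewrite m≤n⇒m∸n≡0 a≤b | m+n∸m≡n a t | ℤₚ.pos-+ a t =
          trans (ℤₚ.pos-* t t) (identity (ℤ.+ a) (ℤ.+ t))
    where
    identity : ∀ A T → T ℤ.* T ≡ (A ℤ.- (A ℤ.+ T)) ℤ.* (A ℤ.- (A ℤ.+ T))
    identity = ℤ-Solver.solve-∀
  absDiff²-ℤ a b | inj₂ b≤a with m≤n⇒∃[o]m+o≡n b≤a
  ...   | t , refl rewrite m≤n⇒m∸n≡0 b≤a | m+n∸m≡n b t | ℤₚ.pos-+ b t | +-identityʳ t =
          trans (ℤₚ.pos-* t t) (identity (ℤ.+ b) (ℤ.+ t))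
    where
    identity : ∀ B T → T ℤ.* T ≡ ((B ℤ.+ T) ℤ.- B) ℤ.* ((B ℤ.+ T) ℤ.- B)
    identity = ℤ-Solver.solve-∀

parallelogram-ℤ : ∀ A B A' B' → A ℤ.+ B ≡ A' ℤ.+ B' →
  sq (A ℤ.+ A') (B ℤ.+ B') ℤ.+ ℤ.+ 4 ℤ.* sq A A' ≡ ℤ.+ 2 ℤ.* sq A B ℤ.+ ℤ.+ 2 ℤ.* sq A' B'
parallelogram-ℤ A B A' B' sums =
  subst (λ B → sq (A ℤ.+ A') (B ℤ.+ B') ℤ.+ ℤ.+ 4 ℤ.* sq A A' ≡ ℤ.+ 2 ℤ.* sq A B ℤ.+ ℤ.+ 2 ℤ.* sq A' B')
        (solve-B sums) (identity A A' B')
  where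
  solve-B : A ℤ.+ B ≡ A' ℤ.+ B' → (A' ℤ.+ B') ℤ.- A ≡ B
  solve-B e = trans (cong (ℤ._- A) (sym e)) (cancel A B)
    where
    cancel : ∀ A B → (A ℤ.+ B) ℤ.- A ≡ B
    cancel = ℤ-Solver.solve-∀
  -- sq written out, so that the ring solver sees the polynomial
  identity : ∀ A A' B' →
    ((A ℤ.+ A') ℤ.- (((A' ℤ.+ B') ℤ.- A) ℤ.+ B')) ℤ.* ((A ℤ.+ A') ℤ.- (((A' ℤ.+ B') ℤ.- A) ℤ.+ B'))
      ℤ.+ ℤ.+ 4 ℤ.* ((A ℤ.- A') ℤ.* (A ℤ.- A'))
    ≡ ℤ.+ 2 ℤ.* ((A ℤ.- ((A' ℤ.+ B') ℤ.- A)) ℤ.* (A ℤ.- ((A' ℤ.+ B') ℤ.- A)))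
      ℤ.+ ℤ.+ 2 ℤ.* ((A' ℤ.- B') ℤ.* (A' ℤ.- B'))
  identity = ℤ-Solver.solve-∀

parallelogram-coord : ∀ a b a' b' → a + b ≡ a' + b' →
  sqDiff (a + a') (b + b') + 4 * sqDiff a a' ≡ 2 * sqDiff a b + 2 * sqDiff a' b'
parallelogram-coord a b a' b' sums = ℤₚ.+-injective (begin
  ℤ.+ (sqDiff (a + a') (b + b') + 4 * sqDiff a a')
    ≡⟨ trans (ℤₚ.pos-+ (sqDiff (a + a') (b + b')) (4 * sqDiff a a'))
             (cong₂ ℤ._+_ (sqDiff-ℤ (a + a') (b + b'))
                          (trans (ℤₚ.pos-* 4 (sqDiff a a')) (cong (ℤ.+ 4 ℤ.*_) (sqDiff-ℤ a a')))) ⟩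
  sq (ℤ.+ (a + a')) (ℤ.+ (b + b')) ℤ.+ ℤ.+ 4 ℤ.* sq (ℤ.+ a) (ℤ.+ a')
    ≡⟨ cong₂ (λ u v → sq u v ℤ.+ ℤ.+ 4 ℤ.* sq (ℤ.+ a) (ℤ.+ a')) (ℤₚ.pos-+ a a') (ℤₚ.pos-+ b b') ⟩
  sq (ℤ.+ a ℤ.+ ℤ.+ a') (ℤ.+ b ℤ.+ ℤ.+ b') ℤ.+ ℤ.+ 4 ℤ.* sq (ℤ.+ a) (ℤ.+ a')
    ≡⟨ parallelogram-ℤ (ℤ.+ a) (ℤ.+ b) (ℤ.+ a') (ℤ.+ b')
                       (trans (sym (ℤₚ.pos-+ a b)) (trans (cong ℤ.+_ sums) (ℤₚ.pos-+ a' b'))) ⟩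
  ℤ.+ 2 ℤ.* sq (ℤ.+ a) (ℤ.+ b) ℤ.+ ℤ.+ 2 ℤ.* sq (ℤ.+ a') (ℤ.+ b')
    ≡⟨ sym (trans (ℤₚ.pos-+ (2 * sqDiff a b) (2 * sqDiff a' b'))
                  (cong₂ ℤ._+_ (trans (ℤₚ.pos-* 2 (sqDiff a b)) (cong (ℤ.+ 2 ℤ.*_) (sqDiff-ℤ a b)))
                               (trans (ℤₚ.pos-* 2 (sqDiff a' b')) (cong (ℤ.+ 2 ℤ.*_) (sqDiff-ℤ a' b'))))) ⟩
  ℤ.+ (2 * sqDiff a b + 2 * sqDiff a' b') ∎)
  where open ≡-Reasoning

parallelogram : ∀ {m} (x y x' y' : Vec ℕ m) → x +ᵛ y ≡ x' +ᵛ y' →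
  SqDist (x +ᵛ x') (y +ᵛ y') + 4 * SqDist x x' ≡ 2 * SqDist x y + 2 * SqDist x' y'
parallelogram []      []      []        []        _    = refl
parallelogram (a ∷ x) (b ∷ y) (a' ∷ x') (b' ∷ y') sums with ∷-injective sums
... | sums₁ , sums₂ = begin
  (sqDiff (a + a') (b + b') + SqDist (x +ᵛ x') (y +ᵛ y')) + 4 * (sqDiff a a' + SqDist x x')
    ≡⟨ regroup (sqDiff (a + a') (b + b')) (SqDist (x +ᵛ x') (y +ᵛ y')) (sqDiff a a') (SqDist x x') ⟩
  (sqDiff (a + a') (b + b') + 4 * sqDiff a a') + (SqDist (x +ᵛ x') (y +ᵛ y') + 4 * SqDist x x')
    ≡⟨ cong₂ _+_ (parallelogram-coord a b a' b' sums₁) (parallelogram x y x' y' sums₂) ⟩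
  (2 * sqDiff a b + 2 * sqDiff a' b') + (2 * SqDist x y + 2 * SqDist x' y')
    ≡⟨ regroup′ (sqDiff a b) (sqDiff a' b') (SqDist x y) (SqDist x' y') ⟩
  2 * (sqDiff a b + SqDist x y) + 2 * (sqDiff a' b' + SqDist x' y') ∎
  where
  open ≡-Reasoning
  regroup : ∀ u v w z → (u + v) + 4 * (w + z) ≡ (u + 4 * w) + (v + 4 * z)
  regroup = solve-∀
  regroup′ : ∀ u v w z → (2 * u + 2 * v) + (2 * w + 2 * z) ≡ 2 * (u + w) + 2 * (v + z)
  regroup′ = solve-∀

SqDist≡0⇒≡ : ∀ {m} (x y : Vec ℕ m) → SqDist x y ≡ 0 → x ≡ y
SqDist≡0⇒≡ []      []      _ = refl
SqDist≡0⇒≡ (a ∷ x) (b ∷ y) e =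
  cong₂ _∷_ (sqDiff≡0⇒≡ a b (m+n≡0⇒m≡0 _ e)) (SqDist≡0⇒≡ x y (m+n≡0⇒n≡0 (sqDiff a b) e))

two-sums⇒≡ : ∀ {m} (x y x' y' : Vec ℕ m) → x +ᵛ x' ≡ y +ᵛ y' → x +ᵛ y ≡ x' +ᵛ y' → x' ≡ y
two-sums⇒≡ []      []      []        []        _  _  = refl
two-sums⇒≡ (a ∷ x) (b ∷ y) (a' ∷ x') (b' ∷ y') e₁ e₂ with ∷-injective e₁ | ∷-injective e₂
... | e₁₁ , e₁₂ | e₂₁ , e₂₂ = cong₂ _∷_ (coord e₁₁ e₂₁) (two-sums⇒≡ x y x' y' e₁₂ e₂₂)
  where
  coord : a + a' ≡ b + b' → a + b ≡ a' + b' → a' ≡ b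
  coord e e′ = *-cancelˡ-≡ a' b 2 (+-cancelʳ-≡ (a + b') (2 * a') (2 * b) (begin
    2 * a' + (a + b')      ≡⟨ shuffle₁ a a' b' ⟩
    (a + a') + (a' + b')   ≡⟨ cong₂ _+_ e (sym e′) ⟩
    (b + b') + (a + b)     ≡⟨ shuffle₂ a b b' ⟩
    2 * b + (a + b')       ∎))
    where
    open ≡-Reasoning
    shuffle₁ : ∀ a a' b' → 2 * a' + (a + b') ≡ (a + a') + (a' + b')
    shuffle₁ = solve-∀
    shuffle₂ : ∀ a b b' → (b + b') + (a + b) ≡ 2 * b + (a + b')
    shuffle₂ = solve-∀

parallelogram-rigidity : ∀ {m} R (x y x' y' : Vec ℕ m) → SqDist x y ≡ R → SqDist x' y' ≡ R → SqDist x x' ≡ R →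
                         x +ᵛ y ≡ x' +ᵛ y' → x' ≡ y
parallelogram-rigidity R x y x' y' xy x'y' xx' sums =
  two-sums⇒≡ x y x' y' (SqDist≡0⇒≡ (x +ᵛ x') (y +ᵛ y') diagonal≡0) sums
  where
  open ≡-Reasoning
  double : ∀ R → 2 * R + 2 * R ≡ 0 + 4 * R
  double = solve-∀
  diagonal≡0 : SqDist (x +ᵛ x') (y +ᵛ y') ≡ 0
  diagonal≡0 = +-cancelʳ-≡ (4 * R) _ _ (begin
    SqDist (x +ᵛ x') (y +ᵛ y') + 4 * R           ≡⟨ cong (λ z → SqDist (x +ᵛ x') (y +ᵛ y') + 4 * z) (sym xx') ⟩
    SqDist (x +ᵛ x') (y +ᵛ y') + 4 * SqDist x x' ≡⟨ parallelogram x y x' y' sums ⟩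
    2 * SqDist x y + 2 * SqDist x' y'            ≡⟨ cong₂ (λ u v → 2 * u + 2 * v) xy x'y' ⟩
    2 * R + 2 * R                                ≡⟨ double R ⟩
    0 + 4 * R                                    ∎)

does⇒ : ∀ {A : Set} (a? : Dec A) → does a? ≡ true → A
does⇒ (yes a) _ = a

∑-allFin : ∀ n (f : ℕ → ℕ) → sum (map (λ u → f (toℕ u)) (allFin n)) ≡ ∑ n f
∑-allFin n f = trans (cong sum (map-tabulate {n = n} (λ i → i) (λ u → f (toℕ u)))) (∑-tabulate n f)
  where
  ∑-tabulate : ∀ n (f : ℕ → ℕ) → sum (tabulate {n = n} (λ u → f (toℕ u))) ≡ ∑ n f
  ∑-tabulate zero    f = refl
  ∑-tabulate (suc n) f = cong (f 0 +_) (∑-tabulate n (λ i → f (suc i)))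

-- The sphere graph: the first C ^ m vertices are the points of the grid [C]^m,
-- two of them adjacent when their squared distance is R = suc R' (the remaining
-- vertices are isolated).  For each s in [2C]^m the edges xy with x + y = s
-- form an induced matching, by parallelogram-rigidity.
module SphereGraph (n c m R' : ℕ) (grid-fits : suc c ^ m ≤ n) where
  C R : ℕ
  C = suc c
  R = suc R'

  point : ℕ → Vec ℕ m
  point i = digits C m i

  adjacent : ℕ → ℕ → Bool
  adjacent i j = (i <ᵇ C ^ m) ∧ ((j <ᵇ C ^ m) ∧ (SqDist (point i) (point j) ≡ᵇ R))

  adjacent-sym : ∀ i j → adjacent i j ≡ adjacent j i
  adjacent-sym i j rewrite SqDist-sym (point i) (point j) with i <ᵇ C ^ m | j <ᵇ C ^ m
  ... | true  | true  = refl
  ... | true  | false = refl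
  ... | false | true  = refl
  ... | false | false = refl

  adjacent-irrefl : ∀ i → adjacent i i ≡ false
  adjacent-irrefl i rewrite SqDist-diag (point i) with i <ᵇ C ^ m
  ... | true  = refl
  ... | false = refl

  G : SimpleGraph n
  G = record { Adj      = λ u v → adjacent (toℕ u) (toℕ v)
             ; sym      = λ u v → adjacent-sym (toℕ u) (toℕ v)
             ; loopless = λ v → adjacent-irrefl (toℕ v) }

  adjacent⇒ : ∀ i j → adjacent i j ≡ true → i < C ^ m × j < C ^ m × SqDist (point i) (point j) ≡ R
  adjacent⇒ i j e = <ᵇ⇒< i (C ^ m) (≡true⇒T (∧-conicalˡ i∈ _ e)) ,
                     <ᵇ⇒< j (C ^ m) (≡true⇒T (∧-conicalˡ j∈ at-R rest)) ,
                     ≡ᵇ⇒≡ _ R (≡true⇒T (∧-conicalʳ j∈ at-R rest))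
    where
    i∈ j∈ at-R : Bool
    i∈   = i <ᵇ C ^ m
    j∈   = j <ᵇ C ^ m
    at-R = SqDist (point i) (point j) ≡ᵇ R
    rest : j∈ ∧ at-R ≡ true
    rest = ∧-conicalʳ i∈ (j∈ ∧ at-R) e

  -- one matching for each midpoint sum s = digits (2C) m ι
  t : ℕ
  t = (C + C) ^ m

  sum-is : (ι : Fin t) (u v : Fin n) → Dec (point (toℕ u) +ᵛ point (toℕ v) ≡ digits (C + C) m (toℕ ι))
  sum-is ι u v = Vec.≡-dec _≟_ (point (toℕ u) +ᵛ point (toℕ v)) (digits (C + C) m (toℕ ι))

  M : Fin t → EdgeSet n
  M ι u v = adjacent (toℕ u) (toℕ v) ∧ does (sum-is ι u v)

  M⇒ : ∀ ι u v → M ι u v ≡ true →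
       adjacent (toℕ u) (toℕ v) ≡ true × point (toℕ u) +ᵛ point (toℕ v) ≡ digits (C + C) m (toℕ ι)
  M⇒ ι u v e = ∧-conicalˡ _ _ e , does⇒ (sum-is ι u v) (∧-conicalʳ _ _ e)

  M-sym : ∀ ι u v → M ι u v ≡ M ι v u
  M-sym ι u v = cong₂ _∧_ (adjacent-sym (toℕ u) (toℕ v)) sum-sym
    where
    sum-sym : does (sum-is ι u v) ≡ does (sum-is ι v u)
    sum-sym with sum-is ι u v | sum-is ι v u
    ... | yes _  | yes _  = refl
    ... | no  _  | no  _  = refl
    ... | yes uv | no ¬vu = ⊥-elim (¬vu (trans (+ᵛ-comm _ _) uv))
    ... | no ¬uv | yes vu = ⊥-elim (¬uv (trans (+ᵛ-comm _ _) vu))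

  -- two edges at u with the same sum have the same other endpoint
  M-matching : ∀ ι u v w → M ι u v ≡ true → M ι u w ≡ true → v ≡ w
  M-matching ι u v w uv uw with M⇒ ι u v uv | M⇒ ι u w uw
  ... | adj-uv , sum-uv | adj-uw , sum-uw =
    toℕ-injective (digits-injective C m (toℕ v) (toℕ w)
      (proj₁ (proj₂ (adjacent⇒ _ _ adj-uv))) (proj₁ (proj₂ (adjacent⇒ _ _ adj-uw)))
      (+ᵛ-cancelˡ (point (toℕ u)) _ _ (trans sum-uv (sym sum-uw))))

  -- if uw and vw' are in the matching and u ~ v, then v = w, so uv is in it
  M-induced : ∀ ι u v → Covered (M ι) u → Covered (M ι) v → adjacent (toℕ u) (toℕ v) ≡ true → M ι u v ≡ true
  M-induced ι u v (w , uw) (w' , vw') adj-uv with M⇒ ι u w uw | M⇒ ι v w' vw'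
  ... | adj-uw , sum-uw | adj-vw' , sum-vw' =
    cong₂ _∧_ adj-uv (dec-true (sum-is ι u v) (trans (cong (point (toℕ u) +ᵛ_) v≡w) sum-uw))
    where
    v≡w : point (toℕ v) ≡ point (toℕ w)
    v≡w = parallelogram-rigidity R (point (toℕ u)) (point (toℕ w)) (point (toℕ v)) (point (toℕ w'))
            (proj₂ (proj₂ (adjacent⇒ _ _ adj-uw))) (proj₂ (proj₂ (adjacent⇒ _ _ adj-vw')))
            (proj₂ (proj₂ (adjacent⇒ _ _ adj-uv))) (trans sum-uw (sym sum-vw'))

  -- every edge uv lies in the matching of its sum
  M-cover : ∀ u v → adjacent (toℕ u) (toℕ v) ≡ true → ∃[ ι ] M ι u v ≡ true
  M-cover u v adj = fromℕ< s<t , cong₂ _∧_ adj (dec-true (sum-is (fromℕ< s<t) u v) sum≡)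
    where
    s : Vec ℕ m
    s = point (toℕ u) +ᵛ point (toℕ v)
    s-digits : AllLt (C + C) s
    s-digits = +ᵛ-lt C _ _ (digits-lt C m (toℕ u)) (digits-lt C m (toℕ v))
    s<t : undigits (C + C) s < t
    s<t = undigits-lt (C + C) s s-digits
    sum≡ : s ≡ digits (C + C) m (toℕ (fromℕ< s<t))
    sum≡ = sym (trans (cong (digits (C + C) m) (toℕ-fromℕ< s<t)) (digits-undigits (C + C) s s-digits))

  union : IsUnionOfInducedMatchings G t M
  union = (λ ι → record { symM = M-sym ι ; subset = λ u v e → proj₁ (M⇒ ι u v e)
                        ; matching = M-matching ι ; induced = M-induced ι })
        , M-cover

  edges-≥-sphere : PairSum C m (λ x y → 𝟙 (SqDist x y ≡ᵇ R)) ≤ ordAdjCount G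
  edges-≥-sphere = begin
    PairSum C m (λ x y → 𝟙 (SqDist x y ≡ᵇ R))
      ≡⟨ sym (PairSum-as-VecSum C m _) ⟩
    VecSum C m (λ x → VecSum C m (λ y → 𝟙 (SqDist x y ≡ᵇ R)))
      ≡⟨ sym (trans (∑-cong (C ^ m) (λ i → ∑-digits C m _)) (∑-digits C m _)) ⟩
    ∑ (C ^ m) (λ i → ∑ (C ^ m) (λ j → 𝟙 (SqDist (point i) (point j) ≡ᵇ R)))
      ≡⟨ ∑-cong< (C ^ m) (λ i i< → ∑-cong< (C ^ m) (λ j j< → on-grid i j i< j<)) ⟩
    ∑ (C ^ m) (λ i → ∑ (C ^ m) (λ j → 𝟙 (adjacent i j)))
      ≤⟨ ∑-mono (C ^ m) (λ i → ∑-≤-range (C ^ m) n _ grid-fits) ⟩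
    ∑ (C ^ m) (λ i → ∑ n (λ j → 𝟙 (adjacent i j)))
      ≤⟨ ∑-≤-range (C ^ m) n _ grid-fits ⟩
    ∑ n (λ i → ∑ n (λ j → 𝟙 (adjacent i j)))
      ≡⟨ sym ordAdjCount≡ ⟩
    ordAdjCount G ∎
    where
    open ≤-Reasoning
    on-grid : ∀ i j → i < C ^ m → j < C ^ m → 𝟙 (SqDist (point i) (point j) ≡ᵇ R) ≡ 𝟙 (adjacent i j)
    on-grid i j i< j< rewrite T⇒≡true (<⇒<ᵇ i<) | T⇒≡true (<⇒<ᵇ j<) = refl
    if≡𝟙 : ∀ b → (if b then 1 else 0) ≡ 𝟙 b
    if≡𝟙 true  = refl
    if≡𝟙 false = refl
    ordAdjCount≡ : ordAdjCount G ≡ ∑ n (λ i → ∑ n (λ j → 𝟙 (adjacent i j)))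
    ordAdjCount≡ = trans (∑-allFin n (λ i → sum (map (λ v → if adjacent i (toℕ v) then 1 else 0) (allFin n))))
      (∑-cong n (λ i → trans (∑-allFin n (λ j → if adjacent i j then 1 else 0)) (∑-cong n (λ j → if≡𝟙 (adjacent i j)))))

log₂-≥ : ∀ {k n} → 2 ^ k ≤ n → k ≤ ⌊log₂ n ⌋
log₂-≥ {k} 2^k≤n = subst (_≤ _) (⌊log₂[2^n]⌋≡n k) (⌊log₂⌋-mono-≤ 2^k≤n)

2^log₂-≤ : ∀ n → 0 < n → 2 ^ ⌊log₂ n ⌋ ≤ n
2^log₂-≤ = <-rec (λ n → 0 < n → 2 ^ ⌊log₂ n ⌋ ≤ n) step
  where
  step : ∀ n → (∀ {k} → k < n → 0 < k → 2 ^ ⌊log₂ k ⌋ ≤ k) → 0 < n → 2 ^ ⌊log₂ n ⌋ ≤ n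
  step zero           _   ()
  step (suc zero)     _   _ = ≤-reflexive (cong (2 ^_) (⌊log₂[2^n]⌋≡n 0))
  step n@(suc (suc n′)) rec _ = begin
    2 ^ ⌊log₂ n ⌋                     ≡⟨ cong (2 ^_) (sym (m∸n+n≡m 1≤L)) ⟩
    2 ^ (⌊log₂ n ⌋ ∸ 1 + 1)           ≡⟨ cong (2 ^_) (+-comm (⌊log₂ n ⌋ ∸ 1) 1) ⟩
    2 * 2 ^ (⌊log₂ n ⌋ ∸ 1)           ≡⟨ cong (λ e → 2 * 2 ^ e) (sym (⌊log₂⌊n/2⌋⌋≡⌊log₂n⌋∸1 n)) ⟩
    2 * 2 ^ ⌊log₂ ⌊ n /2⌋ ⌋           ≤⟨ *-monoʳ-≤ 2 (rec (⌊n/2⌋<n (suc n′)) (s≤s z≤n)) ⟩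
    2 * ⌊ n /2⌋                       ≡⟨ cong (⌊ n /2⌋ +_) (+-identityʳ ⌊ n /2⌋) ⟩
    ⌊ n /2⌋ + ⌊ n /2⌋                 ≤⟨ +-monoʳ-≤ ⌊ n /2⌋ (⌊n/2⌋≤⌈n/2⌉ n) ⟩
    ⌊ n /2⌋ + ⌈ n /2⌉                 ≡⟨ ⌊n/2⌋+⌈n/2⌉≡n n ⟩
    n                                 ∎
    where
    open ≤-Reasoning
    1≤L : 1 ≤ ⌊log₂ n ⌋
    1≤L = log₂-≥ {1} {n} (s≤s (s≤s z≤n))

<2^1+log₂ : ∀ n → n < 2 ^ suc ⌊log₂ n ⌋
<2^1+log₂ n with n <? 2 ^ suc ⌊log₂ n ⌋
... | yes n< = n<
... | no  n≮ = ⊥-elim (<-irrefl refl (log₂-≥ (≮⇒≥ n≮)))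

n<2^n : ∀ n → n < 2 ^ n
n<2^n zero    = s≤s z≤n
n<2^n (suc n) = ≤-trans (s≤s (n<2^n n)) (subst (_≤ 2 ^ n + (2 ^ n + 0)) (+-comm (2 ^ n) 1)
                  (+-monoʳ-≤ (2 ^ n) (≤-trans (m^n>0 2 n) (m≤m+n (2 ^ n) 0))))

*-^-distrib : ∀ x y m → (x * y) ^ m ≡ x ^ m * y ^ m
*-^-distrib x y zero    = refl
*-^-distrib x y (suc m) = trans (cong ((x * y) *_) (*-^-distrib x y m)) (interchange x y (x ^ m) (y ^ m))
  where
  interchange : ∀ x y u v → (x * y) * (u * v) ≡ (x * u) * (y * v)
  interchange = solve-∀

square-cancel : ∀ x y → x * x ≤ y * y → x ≤ y
square-cancel x y x²≤y² with x ≤? y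
... | yes x≤y = x≤y
... | no  x≰y = ⊥-elim (<⇒≱ (*-mono-< (≰⇒> x≰y) (≰⇒> x≰y)) x²≤y²)

least-square-above : ∀ N → ∃[ k ] (N ≤ k * k × (k ≡ 0 ⊎ (k ∸ 1) * (k ∸ 1) < N))
least-square-above zero    = 0 , z≤n , inj₁ refl
least-square-above (suc N) with least-square-above N
... | k , N≤k² , minimal with suc N ≤? k * k
...   | yes N<k² = k , N<k² , map₂ m<n⇒m<1+n minimal
...   | no  N≮k² = suc k , s≤s (≤-trans (≤-reflexive N≡k²) k²≤) , inj₂ (≰⇒> N≮k²)
  where
  N≡k² : N ≡ k * k
  N≡k² = ≤-antisym N≤k² (≤-pred (≰⇒> N≮k²))
  k²≤ : k * k ≤ k + k * suc k
  k²≤ = ≤-trans (m≤n+m (k * k) (k + k)) (≤-reflexive (trans (+-assoc k k (k * k)) (cong (k +_) (sym (*-suc k k)))))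

ceil-sqrt : ∀ N → 1 ≤ N → ∃[ k ] (1 ≤ k × N ≤ k * k × k * k ≤ 4 * N)
ceil-sqrt N 1≤N with least-square-above N
... | zero  , N≤0  , _         = ⊥-elim (<⇒≱ 1≤N N≤0)
... | suc j , N≤k² , inj₁ ()
... | suc j , N≤k² , inj₂ j²<N = suc j , s≤s z≤n , N≤k² , ≤-trans (square-≤-4× j) (*-monoʳ-≤ 4 j²<N)
  where
  square-≤-4× : ∀ j → suc j * suc j ≤ 4 * suc (j * j)
  square-≤-4× zero    = s≤s z≤n
  square-≤-4× (suc i) = ≤-trans (m≤m+n _ (3 * (i * i) + 4 * i + 4)) (≤-reflexive (expand i))
    where
    expand : ∀ i → (2 + i) * (2 + i) + (3 * (i * i) + 4 * i + 4) ≡ 4 * (1 + (1 + i) * (1 + i))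
    expand = solve-∀

-- Exponents of the grid for k ≈ log n and ℓ ≈ log log n: the grid has side 2 ^ a
-- with a = ⌊ℓ/16⌋ + 1 and dimension m = ⌊k/a⌋, so a m ≤ k < a (m + 1).
record Exponents (k ℓ : ℕ) : Set where
  field
    a m         : ℕ
    m-pos       : 1 ≤ m
    am≤k        : a * m ≤ k
    k<a[1+m]    : k < a * suc m
    am≥2        : 2 ≤ a * m
    a-small     : a * 8 ≤ 8 + ℓ
    a-large     : suc a * m * ℓ ≤ k * (ℓ + 16)

exponents : ∀ k ℓ → 1 ≤ ℓ → 2 ^ ℓ ≤ k → Exponents k ℓ
exponents k ℓ 1≤ℓ 2^ℓ≤k = record
  { a = a ; m = m ; m-pos = m-pos ; am≤k = am≤k ; k<a[1+m] = k<a[1+m] ; am≥2 = am≥2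
  ; a-small = a-small ; a-large = a-large }
  where
  open ≤-Reasoning
  h a m : ℕ
  h = ℓ / 16
  a = suc h
  m = k / a
  ℓ<16a : ℓ < 16 * a
  ℓ<16a = subst (_< 16 * a) (sym (m≡m%n+[m/n]*n ℓ 16))
                (≤-trans (+-monoˡ-< (h * 16) (m%n<n ℓ 16)) (≤-reflexive (*-comm (suc h) 16)))
  a≤ℓ : a ≤ ℓ
  a≤ℓ with m≤n⇒∃[o]m+o≡n 1≤ℓ
  ... | ℓ′ , refl = m/n<m (suc ℓ′) 16 (s≤s (s≤s z≤n))
  ℓ<k : ℓ < k
  ℓ<k = <-≤-trans (n<2^n ℓ) 2^ℓ≤k
  m-pos : 1 ≤ m
  m-pos = subst (_≤ m) (n/n≡1 a) (/-monoˡ-≤ a (≤-trans a≤ℓ (<⇒≤ ℓ<k)))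
  am≤k : a * m ≤ k
  am≤k = subst (_≤ k) (*-comm m a) (m/n*n≤m k a)
  k<a[1+m] : k < a * suc m
  k<a[1+m] = subst₂ _<_ (sym (m≡m%n+[m/n]*n k a)) (trans (cong (a +_) (*-comm m a)) (sym (*-suc a m)))
                   (+-monoˡ-< (m * a) (m%n<n k a))
  am≥2 : 2 ≤ a * m
  am≥2 with 2 ≤? a * m
  ... | yes 2≤am = 2≤am
  ... | no  2≰am = ⊥-elim (<⇒≱ k<a[1+m] (begin
        a * suc m   ≡⟨ *-suc a m ⟩
        a + a * m   ≤⟨ +-mono-≤ a≤ℓ (≤-pred (≰⇒> 2≰am)) ⟩
        ℓ + 1       ≡⟨ +-comm ℓ 1 ⟩
        suc ℓ       ≤⟨ ℓ<k ⟩
        k           ∎))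
  a-small : a * 8 ≤ 8 + ℓ
  a-small = +-monoʳ-≤ 8 (≤-trans (*-monoʳ-≤ h (m≤m+n 8 8)) (m/n*n≤m ℓ 16))
  a-large : suc a * m * ℓ ≤ k * (ℓ + 16)
  a-large = begin
    suc a * m * ℓ            ≡⟨ expand a m ℓ ⟩
    a * m * ℓ + m * ℓ        ≤⟨ +-monoʳ-≤ (a * m * ℓ) (*-monoʳ-≤ m (<⇒≤ ℓ<16a)) ⟩
    a * m * ℓ + m * (16 * a) ≡⟨ collect a m ℓ ⟩
    a * m * (ℓ + 16)         ≤⟨ *-monoˡ-≤ (ℓ + 16) am≤k ⟩
    k * (ℓ + 16)             ∎
    where
    expand : ∀ a m ℓ → (1 + a) * m * ℓ ≡ a * m * ℓ + m * ℓ
    expand = solve-∀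
    collect : ∀ a m ℓ → a * m * ℓ + m * (16 * a) ≡ a * m * (ℓ + 16)
    collect = solve-∀

record GridScale (n : ℕ) : Set where
  field
    c m'          : ℕ
    fits          : suc c ^ suc m' ≤ n
    covers        : n < suc c * suc c ^ suc m'
    grid-large    : 4 ≤ suc c ^ suc m'
    side-small    : (suc c * suc c * (suc c * suc c)) * (suc c * suc c * (suc c * suc c)) ≤ 256 * L₁ n
    dim-small     : suc m' ≤ L₁ n
    few-matchings : ((suc c + suc c) ^ suc m') ^ L₂ n ≤ n ^ (L₂ n + 16)

L₁≥2 : ∀ n → 4 ≤ n → 2 ≤ L₁ n
L₁≥2 n 4≤n = log₂-≥ {2} {n} 4≤n

scale-exponents : ∀ n → 4 ≤ n → Exponents (L₁ n) (L₂ n)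
scale-exponents n 4≤n = exponents (L₁ n) (L₂ n) (log₂-≥ {1} {L₁ n} (L₁≥2 n 4≤n))
                                  (2^log₂-≤ (L₁ n) (≤-trans (s≤s z≤n) (L₁≥2 n 4≤n)))

grid-scale : ∀ n → 4 ≤ n → GridScale n
grid-scale n 4≤n with m≤n⇒∃[o]m+o≡n (m^n>0 2 (Exponents.a (scale-exponents n 4≤n)))
                    | m≤n⇒∃[o]m+o≡n (Exponents.m-pos (scale-exponents n 4≤n))
... | c , C≡2^a | m' , M≡m = record
  { c = c ; m' = m' ; fits = fits ; covers = covers ; grid-large = grid-large
  ; side-small = side-small ; dim-small = dim-small ; few-matchings = few-matchings }
  where
  open ≤-Reasoning
  open Exponents (scale-exponents n 4≤n)
  C M : ℕ
  C = suc c
  M = suc m'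
  C^ : ∀ e → C ^ e ≡ 2 ^ (a * e)
  C^ e = trans (cong (_^ e) C≡2^a) (^-*-assoc 2 a e)
  fits : C ^ M ≤ n
  fits = begin
    C ^ M        ≡⟨ C^ M ⟩
    2 ^ (a * M)  ≤⟨ ^-monoʳ-≤ 2 (subst (λ z → a * z ≤ L₁ n) (sym M≡m) am≤k) ⟩
    2 ^ L₁ n     ≤⟨ 2^log₂-≤ n (≤-trans (s≤s z≤n) 4≤n) ⟩
    n            ∎
  covers : n < C * C ^ M
  covers = begin-strict
    n                <⟨ <2^1+log₂ n ⟩
    2 ^ suc (L₁ n)   ≤⟨ ^-monoʳ-≤ 2 (subst (λ z → L₁ n < a * suc z) (sym M≡m) k<a[1+m]) ⟩
    2 ^ (a * suc M)  ≡⟨ sym (C^ (suc M)) ⟩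
    C * C ^ M        ∎
  grid-large : 4 ≤ C ^ M
  grid-large = subst (4 ≤_) (sym (C^ M)) (^-monoʳ-≤ 2 (subst (λ z → 2 ≤ a * z) (sym M≡m) am≥2))
  side-small : (C * C * (C * C)) * (C * C * (C * C)) ≤ 256 * L₁ n
  side-small = begin
    (C * C * (C * C)) * (C * C * (C * C))  ≡⟨ eighth-power C ⟩
    C ^ 8                                 ≡⟨ C^ 8 ⟩
    2 ^ (a * 8)                           ≤⟨ ^-monoʳ-≤ 2 a-small ⟩
    2 ^ (8 + L₂ n)                        ≡⟨ ^-distribˡ-+-* 2 8 (L₂ n) ⟩
    256 * 2 ^ L₂ n                        ≤⟨ *-monoʳ-≤ 256 (2^log₂-≤ (L₁ n) (≤-trans (s≤s z≤n) (L₁≥2 n 4≤n))) ⟩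
    256 * L₁ n                            ∎
    where
    eighth-power : ∀ x → (x * x * (x * x)) * (x * x * (x * x)) ≡ x * (x * (x * (x * (x * (x * (x * (x * 1)))))))
    eighth-power = solve-∀
  dim-small : M ≤ L₁ n
  dim-small = ≤-trans (m≤n*m M a) (subst (λ z → a * z ≤ L₁ n) (sym M≡m) am≤k)
  few-matchings : ((C + C) ^ M) ^ L₂ n ≤ n ^ (L₂ n + 16)
  few-matchings = begin
    ((C + C) ^ M) ^ L₂ n           ≡⟨ cong (λ z → (z ^ M) ^ L₂ n) 2C≡ ⟩
    ((2 ^ suc a) ^ M) ^ L₂ n       ≡⟨ cong (_^ L₂ n) (^-*-assoc 2 (suc a) M) ⟩
    (2 ^ (suc a * M)) ^ L₂ n       ≡⟨ ^-*-assoc 2 (suc a * M) (L₂ n) ⟩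
    2 ^ (suc a * M * L₂ n)         ≤⟨ ^-monoʳ-≤ 2 (subst (λ z → suc a * z * L₂ n ≤ L₁ n * (L₂ n + 16)) (sym M≡m) a-large) ⟩
    2 ^ (L₁ n * (L₂ n + 16))       ≡⟨ sym (^-*-assoc 2 (L₁ n) (L₂ n + 16)) ⟩
    (2 ^ L₁ n) ^ (L₂ n + 16)       ≤⟨ ^-monoˡ-≤ (L₂ n + 16) (2^log₂-≤ n (≤-trans (s≤s z≤n) 4≤n)) ⟩
    n ^ (L₂ n + 16)                ∎
    where
    2C≡ : C + C ≡ 2 ^ suc a
    2C≡ = cong₂ _+_ C≡2^a (trans C≡2^a (sym (+-identityʳ (2 ^ a))))

-- The density loss factor 4 D W (W = 2kD + 1 the window width) is O(K) = O(log n):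
-- with k² ≤ 32m, D⁴ ≤ 256 K and m ≤ K, we get 4 D W ≤ 1100 K.
window-width-bound : ∀ D k m K → 1 ≤ D → 1 ≤ k → k * k ≤ 4 * (8 * m) → (D * D) * (D * D) ≤ 256 * K → m ≤ K →
                     D * 4 * (2 * k * D + 1) ≤ 1100 * K
window-width-bound D k m K 1≤D 1≤k k²≤ D⁴≤ m≤K = ≤-trans 4DW≤12kD² (square-cancel _ _ squared)
  where
  open ≤-Reasoning
  4DW≤12kD² : D * 4 * (2 * k * D + 1) ≤ 12 * k * (D * D)
  4DW≤12kD² = begin
    D * 4 * (2 * k * D + 1)      ≤⟨ *-monoʳ-≤ (D * 4) (+-monoʳ-≤ (2 * k * D) (*-mono-≤ 1≤k 1≤D)) ⟩
    D * 4 * (2 * k * D + k * D)  ≡⟨ collect k D ⟩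
    12 * k * (D * D)             ∎
    where
    collect : ∀ k D → D * 4 * (2 * k * D + k * D) ≡ 12 * k * (D * D)
    collect = solve-∀
  squared : (12 * k * (D * D)) * (12 * k * (D * D)) ≤ (1100 * K) * (1100 * K)
  squared = begin
    (12 * k * (D * D)) * (12 * k * (D * D))    ≡⟨ regroup k D ⟩
    144 * (k * k) * ((D * D) * (D * D))        ≤⟨ *-mono-≤ (*-monoʳ-≤ 144 k²≤) D⁴≤ ⟩
    144 * (4 * (8 * m)) * (256 * K)            ≤⟨ *-monoˡ-≤ (256 * K) (*-monoʳ-≤ 144 (*-monoʳ-≤ 4 (*-monoʳ-≤ 8 m≤K))) ⟩
    144 * (4 * (8 * K)) * (256 * K)            ≡⟨ expand K 144 4 8 256 ⟩
    1179648 * (K * K)                          ≤⟨ *-monoˡ-≤ (K * K) (m≤m+n 1179648 30352) ⟩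
    1210000 * (K * K)                          ≡⟨ square K 1100 ⟩
    (1100 * K) * (1100 * K)                    ∎
    where
    -- numeric constants are kept abstract so that the ring solver never unfolds them
    regroup : ∀ k D → (12 * k * (D * D)) * (12 * k * (D * D)) ≡ 144 * (k * k) * ((D * D) * (D * D))
    regroup = solve-∀
    expand : ∀ K a b c d → a * (b * (c * K)) * (d * K) ≡ (a * b * c * d) * (K * K)
    expand = solve-∀
    square : ∀ K q → (q * q) * (K * K) ≡ (q * K) * (q * K)
    square = solve-∀

-- When C ^ m ≥ 4, the C ^ m coincident pairs are at most a quarter of all pairs.
pairs-large : ∀ C m → 4 ≤ C ^ m → 4 * C ^ m ≤ (C * C) ^ m
pairs-large C m 4≤C^m = subst (4 * C ^ m ≤_) (sym (*-^-distrib C C m)) (*-monoˡ-≤ (C ^ m) 4≤C^m)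

dense-sphere-graph : ∀ n → GridScale n →
  ∃[ G ] (1 * (n * (n ∸ 1)) ≤ 1100 * L₁ n * ordAdjCount {n} G ×
    ∃[ t ] ∃[ M ] (IsUnionOfInducedMatchings G t M × t ^ (1 * L₂ n) ≤ n ^ (1 * L₂ n + 16)))
dense-sphere-graph n record { c = c ; m' = m' ; fits = fits ; covers = covers ; grid-large = grid-large
                            ; side-small = side-small ; dim-small = dim-small ; few-matchings = few-matchings }
  with ceil-sqrt (8 * suc m') (s≤s z≤n)
... | k , 1≤k , 8m≤k² , k²≤32m with Concentration.popular-radius c m' k 8m≤k² (pairs-large (suc c) (suc m') grid-large)
... | zero   , () , _
... | suc R' , _  , popular =
  G , density , t , M , union , subst (λ e → t ^ e ≤ n ^ (e + 16)) (sym (*-identityˡ (L₂ n))) few-matchings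
  where
  open SphereGraph n c (suc m') R' fits using (G; t; M; union; edges-≥-sphere)
  open Concentration c using (D; Pairs; sphere-count)
  open ≤-Reasoning
  C^m W : ℕ
  C^m = suc c ^ suc m'
  W   = 2 * k * D + 1
  density : 1 * (n * (n ∸ 1)) ≤ 1100 * L₁ n * ordAdjCount G
  density = begin
    1 * (n * (n ∸ 1))                   ≤⟨ ≤-trans (≤-reflexive (*-identityˡ _)) (*-monoʳ-≤ n (m∸n≤m n 1)) ⟩
    n * n                               ≤⟨ *-mono-≤ (<⇒≤ covers) (<⇒≤ covers) ⟩
    (suc c * C^m) * (suc c * C^m)       ≡⟨ interchange (suc c) C^m ⟩
    D * (C^m * C^m)                     ≡⟨ cong (D *_) (sym (*-^-distrib (suc c) (suc c) (suc m'))) ⟩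
    D * Pairs (suc m')                  ≤⟨ *-monoʳ-≤ D popular ⟩
    D * (4 * W * sphere-count (suc m') (suc R')) ≡⟨ reassoc D W _ ⟩
    (D * 4 * W) * sphere-count (suc m') (suc R')
      ≤⟨ *-mono-≤ (window-width-bound D k (suc m') (L₁ n) (s≤s z≤n) 1≤k k²≤32m side-small dim-small) edges-≥-sphere ⟩
    1100 * L₁ n * ordAdjCount G         ∎
    where
    interchange : ∀ x y → (x * y) * (x * y) ≡ (x * x) * (y * y)
    interchange = solve-∀
    reassoc : ∀ D W N → D * (4 * W * N) ≡ (D * 4 * W) * N
    reassoc = solve-∀

-- Lemma 2.2 with c₁ = 1/1100 and c₂ = 16, for all n ≥ 4.
lemma2p2 : ∃[ p₁ ] ∃[ q₁ ] ∃[ p₂ ] ∃[ q₂ ] (0 < p₁ × 0 < q₁ × 0 < p₂ × 0 < q₂ ×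
             ∃[ N ] (∀ n → N ≤ n →
               ∃[ G ] (p₁ * (n * (n ∸ 1)) ≤ q₁ * L₁ n * ordAdjCount {n} G ×
                 ∃[ t ] ∃[ M ] (IsUnionOfInducedMatchings G t M ×
                   t ^ (q₂ * L₂ n) ≤ n ^ (q₂ * L₂ n + p₂)))))
lemma2p2 = 1 , 1100 , 16 , 1 , s≤s z≤n , s≤s z≤n , s≤s z≤n , s≤s z≤n ,
           4 , λ n 4≤n → dense-sphere-graph n (grid-scale n 4≤n)
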